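{- The pre-Lie Magnus element $\dot{\Omega}(\bullet)$ of the completed free pre-Lie algebra $\widehat{\mathcal{T}}$ on one generator satisfies $$\dot{\Omega}(\bullet)=\sum_{\tau\in T^{e1}_{pl}}\ \sum_{s\in T}\gamma(\tau)\,\alpha(s,\tau)\,s .$$
   Context: $T$ is the set of (non-planar) rooted trees, $\mathcal{T}$ its linear span with grafting $s\to t=\sum_{v\in V(t)}s\circ_v t$ ($s\circ_v t$: attach the root of $s$ to vertex $v$ of $t$); $(\mathcal{T},\to)$ is the free pre-Lie algebra on $\bullet$, and $\widehat{\mathcal{T}}$ its completion (formal infinite sums) with respect to the grading by number of vertices. The pre-Lie Magnus element $\dot{\Omega}(\bullet)\in\widehat{\mathcal{T}}$ is the unique solution of $\dot{\Omega}=\sum_{m\ge0}\frac{B_m}{m!}L_{\dot{\Omega}}^m(\bullet)$, where $L_y(z)=y\to z$ and $B_m$ are Bernoulli numbers ($\frac{z}{e^z-1}=\sum_m \frac{B_m}{m!}z^m$). Planar rooted trees are written uniquely as $B_+(\tau_1\cdots\tau_k)$; $f(v)$ denotes the fertility (number of children) of a vertex $v$; $\gamma(\tau)=\prod_{v\in V(\tau)}\frac{B_{f(v)}}{f(v)!}$. $T^{e1}_{pl}$ is the set of planar rooted trees having no vertex of fertility $2n+1$ with $n>0$. The map $\overline{\Psi}$ from planar rooted trees to $\mathcal{T}$ is defined by $\overline{\Psi}(\bullet)=\bullet$ and $\overline{\Psi}(B_+(\tau_1\cdots\tau_k))=\overline{\Psi}(\tau_1)\to(\overline{\Psi}(\tau_2)\to(\cdots\to(\overline{\Psi}(\tau_k)\to\bullet)\cdots))$,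 and the coefficients $\alpha(s,\tau)$ are defined by $\overline{\Psi}(\tau)=\sum_{s\in T}\alpha(s,\tau)\,s$. -}

module Defs where

open import Data.Nat using (ℕ; zero; suc; _∸_; _≤ᵇ_)
open import Data.Bool using (Bool; true; false; _∧_; not; if_then_else_)
open import Data.List using (List; []; _∷_; _++_; map; concatMap; foldr; filter; upTo; [_])
open import Data.Product using (_×_; _,_)
open import Data.Integer using (+_)
open import Data.Rational using (ℚ; 0ℚ; 1ℚ; _+_; _*_; -_; _/_)
open import Relation.Binary.PropositionalEquality using (_≡_)
open import Relation.Nullary.Decidable using (⌊_⌋)
open import Data.Nat using (_≟_)

-- Planar rooted trees: a root together with an ordered list of subtrees.
-- node [] = •,  node (τ₁ ∷ … ∷ τₖ) = B₊(τ₁ ⋯ τₖ).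
-- Non-planar rooted trees (the set T) are represented by planar
-- representatives, identified up to isomorphism via the canonical form
-- `canon` below.

data PTree : Set where
  node : List PTree → PTree

• : PTree
• = node []

mutual
  size : PTree → ℕ
  size (node ts) = suc (sizeF ts)

  sizeF : List PTree → ℕ
  sizeF [] = zero
  sizeF (t ∷ ts) = size t Data.Nat.+ sizeF ts

data Ord3 : Set where lt eq gt : Ord3

mutual
  cmp : PTree → PTree → Ord3
  cmp (node xs) (node ys) = cmpF xs ys

  cmpF : List PTree → List PTree → Ord3
  cmpF [] [] = eq
  cmpF [] (_ ∷ _) = lt
  cmpF (_ ∷ _) [] = gt
  cmpF (x ∷ xs) (y ∷ ys) with cmp x y
  ... | eq = cmpF xs ys
  ... | lt = lt
  ... | gt = gt

leq : PTree → PTree → Bool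
leq x y with cmp x y
... | gt = false
... | _  = true

eqT : PTree → PTree → Bool
eqT x y with cmp x y
... | eq = true
... | _  = false

insert : PTree → List PTree → List PTree
insert x [] = x ∷ []
insert x (y ∷ ys) = if leq x y then x ∷ y ∷ ys else y ∷ insert x ys

sortT : List PTree → List PTree
sortT = foldr insert []

mutual
  canon : PTree → PTree
  canon (node ts) = node (sortT (canonF ts))

  canonF : List PTree → List PTree
  canonF [] = []
  canonF (t ∷ ts) = canon t ∷ canonF ts

sameTree : PTree → PTree → Bool
sameTree s t = eqT (canon s) (canon t)

isCanonical : PTree → Bool
isCanonical t = eqT (canon t) t

-- Enumeration of planar rooted trees with a given number of vertices
-- (fuel argument first; fuel ≥ size suffices).

mutual
  treesF : ℕ → ℕ → List PTree
  treesF zero _ = []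
  treesF (suc f) zero = []
  treesF (suc f) (suc n) = map node (forestsF f n)

  forestsF : ℕ → ℕ → List (List PTree)
  forestsF _ zero = [] ∷ []
  forestsF zero (suc _) = []
  forestsF (suc f) (suc n) =
    concatMap (λ k → concatMap (λ t → map (t ∷_) (forestsF f (suc n ∸ suc k)))
                               (treesF (suc f) (suc k)))
              (upTo (suc n))

planarTrees : ℕ → List PTree
planarTrees n = treesF n n

nonPlanarTrees : ℕ → List PTree
nonPlanarTrees n = filter (λ t → isCanonical t Data.Bool.≟ true) (planarTrees n)

-- The free pre-Lie algebra 𝒯 over ℚ: finite formal ℚ-linear combinations
-- of (representatives of) rooted trees.

Lin : Set
Lin = List (ℚ × PTree)

sumℚ : List ℚ → ℚ
sumℚ = foldr _+_ 0ℚ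

coefL : PTree → Lin → ℚ
coefL s x = sumℚ (map (λ { (q , u) → if sameTree s u then q else 0ℚ }) x)

-- all trees s ∘_v t, v ∈ V(t) (s attached as an extra child of v)
mutual
  graftAt : PTree → PTree → List PTree
  graftAt s (node ts) = node (ts ++ [ s ]) ∷ map node (graftAtF s ts)

  graftAtF : PTree → List PTree → List (List PTree)
  graftAtF s [] = []
  graftAtF s (t ∷ ts) = map (_∷ ts) (graftAt s t) ++ map (t ∷_) (graftAtF s ts)

_⇀_ : Lin → Lin → Lin
x ⇀ y = concatMap (λ { (a , s) → concatMap (λ { (b , t) →
          map (λ u → (a * b , u)) (graftAt s t) }) y }) x

infixr 5 _⇀_

•L : Lin
•L = (1ℚ , •) ∷ []

iterL : ℕ → Lin → Lin
iterL zero y = •L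
iterL (suc m) y = y ⇀ iterL m y

-- Bernoulli numbers, as bern m = B_m / m!, defined by
-- z/(e^z - 1) = Σ_m bern m · z^m, i.e. (since (e^z-1)/z = Σ_j z^j/(j+1)!)
-- bern 0 = 1 and Σ_{k=0}^{m} bern k / (m+1-k)! = 0 for m ≥ 1.

invFact : ℕ → ℚ
invFact zero = 1ℚ
invFact (suc n) = invFact n * (+ 1 / suc n)

-- bernRev m = bern m ∷ bern (m-1) ∷ ⋯ ∷ bern 0
bernStep : ℕ → List ℚ → ℚ
bernStep j [] = 0ℚ
bernStep j (b ∷ bs) = b * invFact (suc (suc j)) + bernStep (suc j) bs

bernRev : ℕ → List ℚ
bernRev zero = 1ℚ ∷ []
bernRev (suc m) = (- bernStep 0 (bernRev m)) ∷ bernRev m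

bern : ℕ → ℚ
bern m with bernRev m
... | [] = 0ℚ
... | b ∷ _ = b

-- Formal infinite sums (elements of the completion 𝒯̂): coefficient
-- functions on trees; only values at canonical representatives matter.

Series : Set
Series = PTree → ℚ

coef : Series → PTree → ℚ
coef X s = X (canon s)

_≈S_ : Series → Series → Set
X ≈S Y = ∀ s → coef X s ≡ coef Y s

trunc : ℕ → Series → Lin
trunc n X = concatMap (λ k → map (λ t → (X t , t)) (nonPlanarTrees k)) (upTo (suc n))

sumTo : ℕ → (ℕ → ℚ) → ℚ
sumTo n f = sumℚ (map f (upTo (suc n)))

-- X = Σ_{m≥0} (B_m/m!) L_X^m(•), read off coefficientwise.  For a tree s
-- with n vertices only the terms m ≤ n and the part of X of degree ≤ n
-- can contribute (grafting adds degrees; trees have ≥ 1 vertex).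
IsMagnus : Series → Set
IsMagnus X = ∀ s → coef X s ≡
  sumTo (size s) (λ m → bern m * coefL s (iterL m (trunc (size s) X)))

isOdd : ℕ → Bool
isOdd zero = false
isOdd (suc n) = not (isOdd n)

fertOK : ℕ → Bool
fertOK f = not ((3 ≤ᵇ f) ∧ isOdd f)

mutual
  isE1 : PTree → Bool
  isE1 (node ts) = fertOK (Data.List.length ts) ∧ isE1F ts

  isE1F : List PTree → Bool
  isE1F [] = true
  isE1F (t ∷ ts) = isE1 t ∧ isE1F ts

mutual
  γ : PTree → ℚ
  γ (node ts) = bern (Data.List.length ts) * γF ts

  γF : List PTree → ℚ
  γF [] = 1ℚ
  γF (t ∷ ts) = γ t * γF ts

mutual
  Ψ : PTree → Lin
  Ψ (node ts) = ΨF ts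

  ΨF : List PTree → Lin
  ΨF [] = •L
  ΨF (t ∷ ts) = Ψ t ⇀ ΨF ts

α : PTree → PTree → ℚ
α s τ = coefL s (Ψ τ)

-- the right-hand side  Σ_{τ ∈ T^{e1}_pl} Σ_{s ∈ T} γ(τ) α(s,τ) s ;
-- coefficient of s (only τ with |τ| = |s| contribute, Ψ̄ preserves size)
rhs : Series
rhs s = sumℚ (map (λ τ → γ τ * α s τ)
                  (filter (λ τ → isE1 τ Data.Bool.≟ true) (planarTrees (size s))))

-- Uniqueness: grafting adds numbers of vertices, so the Magnus equation expresses the
-- coefficient of a tree s through coefficients of trees with fewer vertices, and induction on
-- the size of s applies.
-- Existence: by bilinearity of grafting, L_Y^m(•) for Y = Σ_τ γ(τ) Ψ̄(τ) is the sum over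
-- m-tuples (τ₁,…,τₘ) of γ(τ₁)⋯γ(τₘ) Ψ̄(B₊(τ₁⋯τₘ)), and the factor B_m/m! turns this weight
-- into γ(B₊(τ₁⋯τₘ)). Summing over m gives all planar trees whose root subtrees lie in T^{e1}_pl;
-- the condition at the root is then free because B_{2n+1} = 0 for n > 0, which is the
-- identity eᶻ·z/(eᶻ-1) = -z/(e⁻ᶻ-1) read coefficientwise.

module Submission where

open import Defs
open import Algebra.Bundles using (CommutativeMonoid)
open import Data.Bool using (Bool; true; false; if_then_else_; _∧_; not; T)
open import Data.Empty using (⊥; ⊥-elim)
import Data.Integer as ℤ
import Data.Integer.Properties as ℤₚ
open import Data.List using (List; []; _∷_; _++_; map; concatMap; concat; filter; upTo; length; [_])
import Data.List.Properties as List
open import Data.List.Relation.Unary.All as All using (All; []; _∷_)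
import Data.List.Relation.Unary.All.Properties as All
open import Data.Nat as ℕ using (ℕ; zero; suc; _<_; _≤_; s≤s; z≤n; _≡ᵇ_; _<ᵇ_; _∸_)
open import Data.Nat.Induction using (<-rec)
import Data.Nat.Properties as ℕₚ
open import Data.Product using (_×_; _,_; proj₁; proj₂)
open import Data.Rational using (ℚ; 0ℚ; 1ℚ; _+_; _*_; -_; _-_; _/_)
open import Data.Rational.Properties
open import Data.Rational.Solver using (module +-*-Solver)
import Data.Rational.Unnormalised as ℚᵘ
import Data.Rational.Unnormalised.Properties as ℚᵘₚ
open import Data.Unit using (tt)
open import Function using (_∘_; id)
open import Relation.Binary.PropositionalEquality hiding ([_])
open import Relation.Nullary using (yes; no)

open import Algebra.Properties.CommutativeSemigroup ℕₚ.+-commutativeSemigroup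
  using () renaming (x∙yz≈y∙xz to +-leftComm)
open import Algebra.Properties.CommutativeSemigroup (CommutativeMonoid.commutativeSemigroup +-0-commutativeMonoid)
  using () renaming (x∙yz≈y∙xz to ℚ-+-leftComm)
open import Algebra.Properties.Group +-0-group using () renaming (∙-cancelˡ to +-cancelˡ)
open ≡-Reasoning
open +-*-Solver

∑ : {A : Set} → (A → ℚ) → List A → ℚ
∑ f xs = sumℚ (map f xs)

∑< : ℕ → (ℕ → ℚ) → ℚ
∑< n f = ∑ f (upTo n)

when : Bool → ℚ → ℚ
when b v = if b then v else 0ℚ

module _ {A : Set} where

  ∑-++ : (f : A → ℚ) (xs ys : List A) → ∑ f (xs ++ ys) ≡ ∑ f xs + ∑ f ys
  ∑-++ f [] ys = sym (+-identityˡ _)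
  ∑-++ f (x ∷ xs) ys = trans (cong (f x +_) (∑-++ f xs ys)) (sym (+-assoc (f x) _ _))

  ∑-cong : {f g : A → ℚ} → (∀ x → f x ≡ g x) → (xs : List A) → ∑ f xs ≡ ∑ g xs
  ∑-cong e [] = refl
  ∑-cong e (x ∷ xs) = cong₂ _+_ (e x) (∑-cong e xs)

  ∑-congᴬ : {P : A → Set} {f g : A → ℚ} {xs : List A} → All P xs → (∀ x → P x → f x ≡ g x) → ∑ f xs ≡ ∑ g xs
  ∑-congᴬ [] e = refl
  ∑-congᴬ (px ∷ pxs) e = cong₂ _+_ (e _ px) (∑-congᴬ pxs e)

  ∑-zero : {f : A → ℚ} → (∀ x → f x ≡ 0ℚ) → (xs : List A) → ∑ f xs ≡ 0ℚ
  ∑-zero e [] = refl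
  ∑-zero e (x ∷ xs) = trans (cong₂ _+_ (e x) (∑-zero e xs)) (+-identityˡ 0ℚ)

  ∑-+ : (f g : A → ℚ) (xs : List A) → ∑ (λ x → f x + g x) xs ≡ ∑ f xs + ∑ g xs
  ∑-+ f g [] = sym (+-identityˡ 0ℚ)
  ∑-+ f g (x ∷ xs) = trans (cong (f x + g x +_) (∑-+ f g xs))
    (solve 4 (λ a b c d → (a :+ b) :+ (c :+ d) := (a :+ c) :+ (b :+ d)) refl (f x) (g x) (∑ f xs) (∑ g xs))

  ∑-*ˡ : (c : ℚ) (f : A → ℚ) (xs : List A) → c * ∑ f xs ≡ ∑ (λ x → c * f x) xs
  ∑-*ˡ c f [] = *-zeroʳ c
  ∑-*ˡ c f (x ∷ xs) = trans (*-distribˡ-+ c (f x) _) (cong (c * f x +_) (∑-*ˡ c f xs))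

  ∑-*ʳ : (c : ℚ) (f : A → ℚ) (xs : List A) → ∑ f xs * c ≡ ∑ (λ x → f x * c) xs
  ∑-*ʳ c f xs = trans (*-comm _ c) (trans (∑-*ˡ c f xs) (∑-cong (λ x → *-comm c (f x)) xs))

  ∑-neg : (f : A → ℚ) (xs : List A) → ∑ (λ x → - f x) xs ≡ - ∑ f xs
  ∑-neg f [] = refl
  ∑-neg f (x ∷ xs) = trans (cong (- f x +_) (∑-neg f xs)) (sym (neg-distrib-+ (f x) _))

  ∑-concat : (f : A → ℚ) (xss : List (List A)) → ∑ f (concat xss) ≡ ∑ (∑ f) xss
  ∑-concat f [] = refl
  ∑-concat f (xs ∷ xss) = trans (∑-++ f xs (concat xss)) (cong (∑ f xs +_) (∑-concat f xss))

  ∑-filter : (p : A → Bool) (f : A → ℚ) (xs : List A) →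
    ∑ f (filter (λ x → p x Data.Bool.≟ true) xs) ≡ ∑ (λ x → when (p x) (f x)) xs
  ∑-filter p f [] = refl
  ∑-filter p f (x ∷ xs) with p x
  ... | true = cong (f x +_) (∑-filter p f xs)
  ... | false = trans (∑-filter p f xs) (sym (+-identityˡ _))

  ∑-when : (b : Bool) (f : A → ℚ) (xs : List A) → ∑ (λ x → when b (f x)) xs ≡ when b (∑ f xs)
  ∑-when true f xs = refl
  ∑-when false f xs = ∑-zero (λ _ → refl) xs

∑-map : {A B : Set} (f : B → ℚ) (h : A → B) (xs : List A) → ∑ f (map h xs) ≡ ∑ (f ∘ h) xs
∑-map f h [] = refl
∑-map f h (x ∷ xs) = cong (f (h x) +_) (∑-map f h xs)

module _ {A B : Set} where

  ∑-concatMap : (f : B → ℚ) (h : A → List B) (xs : List A) →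
    ∑ f (concatMap h xs) ≡ ∑ (λ x → ∑ f (h x)) xs
  ∑-concatMap f h xs = trans (∑-concat f (map h xs)) (∑-map (∑ f) h xs)

  ∑-comm : (f : A → B → ℚ) (xs : List A) (ys : List B) →
    ∑ (λ x → ∑ (f x) ys) xs ≡ ∑ (λ y → ∑ (λ x → f x y) xs) ys
  ∑-comm f [] ys = sym (∑-zero (λ _ → refl) ys)
  ∑-comm f (x ∷ xs) ys = trans (cong (∑ (f x) ys +_) (∑-comm f xs ys))
                               (sym (∑-+ (f x) (λ y → ∑ (λ x → f x y) xs) ys))

when-∧ : ∀ a b v → when (a ∧ b) v ≡ when a (when b v)
when-∧ true b v = refl
when-∧ false b v = refl

when-0 : ∀ b → when b 0ℚ ≡ 0ℚ
when-0 true = refl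
when-0 false = refl

when-*ʳ : ∀ b a v → when b a * v ≡ when b (a * v)
when-*ʳ true a v = refl
when-*ʳ false a v = *-zeroˡ v

upTo-< : ∀ n → All (_< n) (upTo n)
upTo-< n = All.applyUpTo⁺₁ id n id

∑<-cong : ∀ n {f g : ℕ → ℚ} → (∀ k → k < n → f k ≡ g k) → ∑< n f ≡ ∑< n g
∑<-cong n = ∑-congᴬ (upTo-< n)

∑<-zero : ∀ n {f : ℕ → ℚ} → (∀ k → k < n → f k ≡ 0ℚ) → ∑< n f ≡ 0ℚ
∑<-zero n e = trans (∑<-cong n e) (∑-zero (λ _ → refl) (upTo n))

∑<-suc : ∀ n f → ∑< (suc n) f ≡ f 0 + ∑< n (f ∘ suc)
∑<-suc n f = cong (f 0 +_) (trans (cong (∑ f) (sym (List.map-upTo suc n))) (∑-map f suc (upTo n)))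

∑<-sucʳ : ∀ n f → ∑< (suc n) f ≡ ∑< n f + f n
∑<-sucʳ n f = begin
  ∑< (suc n) f              ≡⟨ cong (∑ f) (sym (List.upTo-∷ʳ n)) ⟩
  ∑ f (upTo n ++ [ n ])     ≡⟨ ∑-++ f (upTo n) [ n ] ⟩
  ∑< n f + (f n + 0ℚ)       ≡⟨ cong (∑< n f +_) (+-identityʳ (f n)) ⟩
  ∑< n f + f n              ∎

∑<-extend : ∀ m n {f : ℕ → ℚ} → m ≤ n → (∀ k → m ≤ k → f k ≡ 0ℚ) → ∑< n f ≡ ∑< m f
∑<-extend m n {f} m≤n vanish = trans (cong (λ z → ∑< z f) (sym (ℕₚ.m+[n∸m]≡n m≤n))) (by (n ∸ m))
  where
  by : ∀ d → ∑< (m ℕ.+ d) f ≡ ∑< m f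
  by zero = cong (λ z → ∑< z f) (ℕₚ.+-identityʳ m)
  by (suc d) = begin
    ∑< (m ℕ.+ suc d) f            ≡⟨ cong (λ z → ∑< z f) (ℕₚ.+-suc m d) ⟩
    ∑< (suc (m ℕ.+ d)) f          ≡⟨ ∑<-sucʳ (m ℕ.+ d) f ⟩
    ∑< (m ℕ.+ d) f + f (m ℕ.+ d)  ≡⟨ cong₂ _+_ (by d) (vanish _ (ℕₚ.m≤m+n m d)) ⟩
    ∑< m f + 0ℚ                   ≡⟨ +-identityʳ _ ⟩
    ∑< m f                        ∎

∑<-indicator : ∀ n j (F : ℕ → ℚ) → ∑< n (λ k → when (k ≡ᵇ j) (F k)) ≡ when (j <ᵇ n) (F j)
∑<-indicator zero j F = refl
∑<-indicator (suc n) zero F = begin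
  ∑< (suc n) (λ k → when (k ≡ᵇ 0) (F k))  ≡⟨ ∑<-suc n (λ k → when (k ≡ᵇ 0) (F k)) ⟩
  F 0 + ∑< n (λ _ → 0ℚ)                   ≡⟨ cong (F 0 +_) (∑<-zero n (λ _ _ → refl)) ⟩
  F 0 + 0ℚ                                 ≡⟨ +-identityʳ _ ⟩
  F 0                                      ∎
∑<-indicator (suc n) (suc j) F = begin
  ∑< (suc n) (λ k → when (k ≡ᵇ suc j) (F k))  ≡⟨ ∑<-suc n (λ k → when (k ≡ᵇ suc j) (F k)) ⟩
  0ℚ + ∑< n (λ k → when (k ≡ᵇ j) (F (suc k)))  ≡⟨ +-identityˡ _ ⟩
  ∑< n (λ k → when (k ≡ᵇ j) (F (suc k)))       ≡⟨ ∑<-indicator n j (F ∘ suc) ⟩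
  when (j <ᵇ n) (F (suc j))                    ∎

-- Power series and Bernoulli numbers

PowerSeries : Set
PowerSeries = ℕ → ℚ

infixl 7 _⊛_

_⊛_ : PowerSeries → PowerSeries → PowerSeries
(a ⊛ c) n = ∑< (suc n) (λ i → a i * c (n ∸ i))

δ₀ : PowerSeries
δ₀ zero = 1ℚ
δ₀ (suc _) = 0ℚ

sign : ℕ → ℚ
sign zero = 1ℚ
sign (suc n) = - sign n

reflect : PowerSeries → PowerSeries
reflect a i = sign i * a i

⊛-congˡ : ∀ {a a'} c → (∀ i → a i ≡ a' i) → ∀ n → (a ⊛ c) n ≡ (a' ⊛ c) n
⊛-congˡ c a≗a' n = ∑-cong (λ i → cong (_* c (n ∸ i)) (a≗a' i)) (upTo (suc n))

⊛-congʳ : ∀ a {c c'} → (∀ i → c i ≡ c' i) → ∀ n → (a ⊛ c) n ≡ (a ⊛ c') n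
⊛-congʳ a c≗c' n = ∑-cong (λ i → cong (a i *_) (c≗c' (n ∸ i))) (upTo (suc n))

1+n∸i : ∀ n i → i < suc n → suc n ∸ i ≡ suc (n ∸ i)
1+n∸i n i (s≤s i≤n) = ℕₚ.+-∸-assoc 1 i≤n

∑<-reverse : ∀ n (f : ℕ → ℚ) → ∑< (suc n) f ≡ ∑< (suc n) (λ i → f (n ∸ i))
∑<-reverse zero f = refl
∑<-reverse (suc n) f = begin
  ∑< (suc (suc n)) f
    ≡⟨ ∑<-suc (suc n) f ⟩
  f 0 + ∑< (suc n) (f ∘ suc)
    ≡⟨ cong (f 0 +_) (∑<-reverse n (f ∘ suc)) ⟩
  f 0 + ∑< (suc n) (λ i → f (suc (n ∸ i)))
    ≡⟨ +-comm (f 0) _ ⟩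
  ∑< (suc n) (λ i → f (suc (n ∸ i))) + f 0
    ≡⟨ cong₂ _+_ (∑<-cong (suc n) (λ i i<1+n → cong f (sym (1+n∸i n i i<1+n)))) (cong f (sym (ℕₚ.n∸n≡0 n))) ⟩
  ∑< (suc n) (λ i → f (suc n ∸ i)) + f (suc n ∸ suc n)
    ≡⟨ ∑<-sucʳ (suc n) (λ i → f (suc n ∸ i)) ⟨
  ∑< (suc (suc n)) (λ i → f (suc n ∸ i)) ∎

⊛-comm : ∀ a c n → (a ⊛ c) n ≡ (c ⊛ a) n
⊛-comm a c n = trans (∑<-reverse n (λ i → a i * c (n ∸ i))) (∑<-cong (suc n) (λ i i<1+n →
  trans (cong (λ j → a (n ∸ i) * c j) (ℕₚ.m∸[m∸n]≡n (ℕₚ.≤-pred i<1+n))) (*-comm (a (n ∸ i)) (c i))))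

∑<-triangle : ∀ n (F : ℕ → ℕ → ℚ) →
  ∑< (suc n) (λ k → ∑< (suc k) (λ i → F i k)) ≡ ∑< (suc n) (λ i → ∑< (suc (n ∸ i)) (λ j → F i (i ℕ.+ j)))
∑<-triangle zero F = refl
∑<-triangle (suc n) F = begin
  ∑< (suc (suc n)) (λ k → ∑< (suc k) (λ i → F i k))
    ≡⟨ ∑<-sucʳ (suc n) (λ k → ∑< (suc k) (λ i → F i k)) ⟩
  ∑< (suc n) (λ k → ∑< (suc k) (λ i → F i k)) + ∑< (suc (suc n)) (λ i → F i (suc n))
    ≡⟨ cong₂ _+_ (∑<-triangle n F) (∑<-sucʳ (suc n) (λ i → F i (suc n))) ⟩
  L + (∑< (suc n) (λ i → F i (suc n)) + F (suc n) (suc n))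
    ≡⟨ +-assoc L _ _ ⟨
  L + ∑< (suc n) (λ i → F i (suc n)) + F (suc n) (suc n)
    ≡⟨ cong (_+ F (suc n) (suc n)) (∑-+ (λ i → ∑< (suc (n ∸ i)) (λ j → F i (i ℕ.+ j))) (λ i → F i (suc n)) (upTo (suc n))) ⟨
  ∑< (suc n) (λ i → ∑< (suc (n ∸ i)) (λ j → F i (i ℕ.+ j)) + F i (suc n)) + F (suc n) (suc n)
    ≡⟨ cong₂ _+_ (∑<-cong (suc n) (λ i i<1+n → extendRow i (ℕₚ.≤-pred i<1+n))) (lastRow) ⟩
  ∑< (suc n) (λ i → ∑< (suc (suc n ∸ i)) (λ j → F i (i ℕ.+ j))) + ∑< (suc (suc n ∸ suc n)) (λ j → F (suc n) (suc n ℕ.+ j))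
    ≡⟨ ∑<-sucʳ (suc n) (λ i → ∑< (suc (suc n ∸ i)) (λ j → F i (i ℕ.+ j))) ⟨
  ∑< (suc (suc n)) (λ i → ∑< (suc (suc n ∸ i)) (λ j → F i (i ℕ.+ j))) ∎
  where
  L = ∑< (suc n) (λ i → ∑< (suc (n ∸ i)) (λ j → F i (i ℕ.+ j)))
  extendRow : ∀ i → i ≤ n → ∑< (suc (n ∸ i)) (λ j → F i (i ℕ.+ j)) + F i (suc n) ≡ ∑< (suc (suc n ∸ i)) (λ j → F i (i ℕ.+ j))
  extendRow i i≤n = begin
    ∑< (suc (n ∸ i)) (λ j → F i (i ℕ.+ j)) + F i (suc n)
      ≡⟨ cong (λ k → ∑< (suc (n ∸ i)) (λ j → F i (i ℕ.+ j)) + F i k) (trans (cong suc (sym (ℕₚ.m+[n∸m]≡n i≤n))) (sym (ℕₚ.+-suc i (n ∸ i)))) ⟩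
    ∑< (suc (n ∸ i)) (λ j → F i (i ℕ.+ j)) + F i (i ℕ.+ suc (n ∸ i))
      ≡⟨ ∑<-sucʳ (suc (n ∸ i)) (λ j → F i (i ℕ.+ j)) ⟨
    ∑< (suc (suc (n ∸ i))) (λ j → F i (i ℕ.+ j))
      ≡⟨ cong (λ k → ∑< (suc k) (λ j → F i (i ℕ.+ j))) (sym (1+n∸i n i (s≤s i≤n))) ⟩
    ∑< (suc (suc n ∸ i)) (λ j → F i (i ℕ.+ j)) ∎
  lastRow : F (suc n) (suc n) ≡ ∑< (suc (suc n ∸ suc n)) (λ j → F (suc n) (suc n ℕ.+ j))
  lastRow rewrite ℕₚ.n∸n≡0 n | ℕₚ.+-identityʳ n = sym (+-identityʳ _)

⊛-assoc : ∀ a b c n → ((a ⊛ b) ⊛ c) n ≡ (a ⊛ (b ⊛ c)) n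
⊛-assoc a b c n = begin
  ∑< (suc n) (λ k → (a ⊛ b) k * c (n ∸ k))
    ≡⟨ ∑<-cong (suc n) (λ k _ → ∑-*ʳ (c (n ∸ k)) (λ i → a i * b (k ∸ i)) (upTo (suc k))) ⟩
  ∑< (suc n) (λ k → ∑< (suc k) (λ i → a i * b (k ∸ i) * c (n ∸ k)))
    ≡⟨ ∑<-triangle n (λ i k → a i * b (k ∸ i) * c (n ∸ k)) ⟩
  ∑< (suc n) (λ i → ∑< (suc (n ∸ i)) (λ j → a i * b (i ℕ.+ j ∸ i) * c (n ∸ (i ℕ.+ j))))
    ≡⟨ ∑<-cong (suc n) (λ i _ → ∑<-cong (suc (n ∸ i)) (λ j _ →
         trans (cong₂ (λ u v → a i * b u * c v) (ℕₚ.m+n∸m≡n i j) (sym (ℕₚ.∸-+-assoc n i j))) (*-assoc (a i) (b j) _))) ⟩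
  ∑< (suc n) (λ i → ∑< (suc (n ∸ i)) (λ j → a i * (b j * c (n ∸ i ∸ j))))
    ≡⟨ ∑<-cong (suc n) (λ i _ → ∑-*ˡ (a i) (λ j → b j * c (n ∸ i ∸ j)) (upTo (suc (n ∸ i)))) ⟨
  ∑< (suc n) (λ i → a i * (b ⊛ c) (n ∸ i)) ∎

sign-+ : ∀ i j → sign (i ℕ.+ j) ≡ sign i * sign j
sign-+ zero j = sym (*-identityˡ (sign j))
sign-+ (suc i) j = trans (cong -_ (sign-+ i j)) (neg-distribˡ-* (sign i) (sign j))

reflect-⊛ : ∀ a c n → (reflect a ⊛ reflect c) n ≡ reflect (a ⊛ c) n
reflect-⊛ a c n = trans (∑<-cong (suc n) (λ i i<1+n → begin
    sign i * a i * (sign (n ∸ i) * c (n ∸ i))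
      ≡⟨ solve 4 (λ x y z w → x :* y :* (z :* w) := (x :* z) :* (y :* w)) refl (sign i) (a i) (sign (n ∸ i)) (c (n ∸ i)) ⟩
    (sign i * sign (n ∸ i)) * (a i * c (n ∸ i))
      ≡⟨ cong (_* (a i * c (n ∸ i))) (trans (sym (sign-+ i (n ∸ i))) (cong sign (ℕₚ.m+[n∸m]≡n (ℕₚ.≤-pred i<1+n)))) ⟩
    sign n * (a i * c (n ∸ i)) ∎))
  (sym (∑-*ˡ (sign n) (λ i → a i * c (n ∸ i)) (upTo (suc n))))

⊛-negʳ : ∀ a c n → (a ⊛ (-_ ∘ c)) n ≡ - (a ⊛ c) n
⊛-negʳ a c n = trans (∑<-cong (suc n) (λ i _ → sym (neg-distribʳ-* (a i) (c (n ∸ i)))))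
                     (∑-neg (λ i → a i * c (n ∸ i)) (upTo (suc n)))

fromℕ : ℕ → ℚ
fromℕ k = ℤ.+ k / 1

fromℕ-+ : ∀ a b → fromℕ (a ℕ.+ b) ≡ fromℕ a + fromℕ b
fromℕ-+ a b = toℚᵘ-injective (ℚᵘₚ.≃-sym (ℚᵘₚ.≃-trans (toℚᵘ-homo-+ (fromℕ a) (fromℕ b))
  (ℚᵘₚ.≃-trans (ℚᵘₚ.+-cong (toℚᵘ-fromℚᵘ (ℚᵘ.mkℚᵘ (ℤ.+ a) 0)) (toℚᵘ-fromℚᵘ (ℚᵘ.mkℚᵘ (ℤ.+ b) 0)))
    (ℚᵘₚ.≃-trans (ℚᵘ.*≡* integers) (ℚᵘₚ.≃-sym (toℚᵘ-fromℚᵘ (ℚᵘ.mkℚᵘ (ℤ.+ (a ℕ.+ b)) 0)))))))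
  where
  integers : (ℤ.+ a ℤ.* ℤ.+ 1 ℤ.+ ℤ.+ b ℤ.* ℤ.+ 1) ℤ.* ℤ.+ 1 ≡ ℤ.+ (a ℕ.+ b) ℤ.* (ℤ.+ 1 ℤ.* ℤ.+ 1)
  integers = begin
    (ℤ.+ a ℤ.* ℤ.+ 1 ℤ.+ ℤ.+ b ℤ.* ℤ.+ 1) ℤ.* ℤ.+ 1  ≡⟨ ℤₚ.*-identityʳ _ ⟩
    ℤ.+ a ℤ.* ℤ.+ 1 ℤ.+ ℤ.+ b ℤ.* ℤ.+ 1              ≡⟨ cong₂ ℤ._+_ (ℤₚ.*-identityʳ (ℤ.+ a)) (ℤₚ.*-identityʳ (ℤ.+ b)) ⟩
    ℤ.+ a ℤ.+ ℤ.+ b                                  ≡⟨ ℤₚ.pos-+ a b ⟨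
    ℤ.+ (a ℕ.+ b)                                    ≡⟨ ℤₚ.*-identityʳ _ ⟨
    ℤ.+ (a ℕ.+ b) ℤ.* (ℤ.+ 1 ℤ.* ℤ.+ 1)              ∎

1/[1+n]*[1+n] : ∀ n → (ℤ.+ 1 / suc n) * fromℕ (suc n) ≡ 1ℚ
1/[1+n]*[1+n] n = toℚᵘ-injective (ℚᵘₚ.≃-trans (toℚᵘ-homo-* (ℤ.+ 1 / suc n) (fromℕ (suc n)))
  (ℚᵘₚ.≃-trans (ℚᵘₚ.*-cong (toℚᵘ-fromℚᵘ (ℚᵘ.mkℚᵘ (ℤ.+ 1) n)) (toℚᵘ-fromℚᵘ (ℚᵘ.mkℚᵘ (ℤ.+ suc n) 0)))
    (ℚᵘ.*≡* (cong (λ z → ℤ.+ suc z) (trans (ℕₚ.*-identityʳ (n ℕ.+ 0)) (trans (ℕₚ.+-identityʳ n)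
      (sym (trans (ℕₚ.+-identityʳ (n ℕ.* 1)) (ℕₚ.*-identityʳ n)))))))))

deriv : PowerSeries → PowerSeries
deriv a n = fromℕ (suc n) * a (suc n)

deriv-⊛ : ∀ a c n → deriv (a ⊛ c) n ≡ (deriv a ⊛ c) n + (a ⊛ deriv c) n
deriv-⊛ a c n = begin
  fromℕ (suc n) * ∑< (suc (suc n)) (λ i → a i * c (suc n ∸ i))
    ≡⟨ ∑-*ˡ (fromℕ (suc n)) _ (upTo (suc (suc n))) ⟩
  ∑< (suc (suc n)) (λ i → fromℕ (suc n) * (a i * c (suc n ∸ i)))
    ≡⟨ ∑<-cong (suc (suc n)) (λ i i<2+n → trans (cong (_* (a i * c (suc n ∸ i)))
         (trans (cong fromℕ (sym (ℕₚ.m+[n∸m]≡n (ℕₚ.≤-pred i<2+n)))) (fromℕ-+ i (suc n ∸ i))))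
         (*-distribʳ-+ (a i * c (suc n ∸ i)) (fromℕ i) (fromℕ (suc n ∸ i)))) ⟩
  ∑< (suc (suc n)) (λ i → fromℕ i * (a i * c (suc n ∸ i)) + fromℕ (suc n ∸ i) * (a i * c (suc n ∸ i)))
    ≡⟨ ∑-+ (λ i → fromℕ i * (a i * c (suc n ∸ i))) (λ i → fromℕ (suc n ∸ i) * (a i * c (suc n ∸ i))) (upTo (suc (suc n))) ⟩
  ∑< (suc (suc n)) (λ i → fromℕ i * (a i * c (suc n ∸ i))) + ∑< (suc (suc n)) (λ i → fromℕ (suc n ∸ i) * (a i * c (suc n ∸ i)))
    ≡⟨ cong₂ _+_ leftFactor rightFactor ⟩
  (deriv a ⊛ c) n + (a ⊛ deriv c) n ∎
  where
  leftFactor : ∑< (suc (suc n)) (λ i → fromℕ i * (a i * c (suc n ∸ i))) ≡ (deriv a ⊛ c) n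
  leftFactor = begin
    ∑< (suc (suc n)) (λ i → fromℕ i * (a i * c (suc n ∸ i)))
      ≡⟨ ∑<-suc (suc n) (λ i → fromℕ i * (a i * c (suc n ∸ i))) ⟩
    fromℕ 0 * (a 0 * c (suc n)) + ∑< (suc n) (λ i → fromℕ (suc i) * (a (suc i) * c (n ∸ i)))
      ≡⟨ cong₂ _+_ (*-zeroˡ (a 0 * c (suc n))) (∑<-cong (suc n) (λ i _ → sym (*-assoc (fromℕ (suc i)) (a (suc i)) (c (n ∸ i))))) ⟩
    0ℚ + (deriv a ⊛ c) n
      ≡⟨ +-identityˡ _ ⟩
    (deriv a ⊛ c) n ∎
  rightFactor : ∑< (suc (suc n)) (λ i → fromℕ (suc n ∸ i) * (a i * c (suc n ∸ i))) ≡ (a ⊛ deriv c) n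
  rightFactor = begin
    ∑< (suc (suc n)) (λ i → fromℕ (suc n ∸ i) * (a i * c (suc n ∸ i)))
      ≡⟨ ∑<-sucʳ (suc n) (λ i → fromℕ (suc n ∸ i) * (a i * c (suc n ∸ i))) ⟩
    ∑< (suc n) (λ i → fromℕ (suc n ∸ i) * (a i * c (suc n ∸ i))) + fromℕ (suc n ∸ suc n) * (a (suc n) * c (suc n ∸ suc n))
      ≡⟨ cong₂ _+_ (∑<-cong (suc n) (λ i i<1+n → trans (cong (λ z → fromℕ z * (a i * c z)) (1+n∸i n i i<1+n))
                      (solve 3 (λ x y z → x :* (y :* z) := y :* (x :* z)) refl (fromℕ (suc (n ∸ i))) (a i) (c (suc (n ∸ i))))))
                   (trans (cong (λ z → fromℕ z * (a (suc n) * c z)) (ℕₚ.n∸n≡0 n)) (*-zeroˡ (a (suc n) * c 0))) ⟩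
    (a ⊛ deriv c) n + 0ℚ
      ≡⟨ +-identityʳ _ ⟩
    (a ⊛ deriv c) n ∎

deriv≡0⇒constant : ∀ a → (∀ n → deriv a n ≡ 0ℚ) → ∀ n → a (suc n) ≡ 0ℚ
deriv≡0⇒constant a a′≡0 n = begin
  a (suc n)                                         ≡⟨ *-identityˡ (a (suc n)) ⟨
  1ℚ * a (suc n)                                    ≡⟨ cong (_* a (suc n)) (1/[1+n]*[1+n] n) ⟨
  (ℤ.+ 1 / suc n) * fromℕ (suc n) * a (suc n)       ≡⟨ *-assoc (ℤ.+ 1 / suc n) (fromℕ (suc n)) (a (suc n)) ⟩
  (ℤ.+ 1 / suc n) * deriv a n                       ≡⟨ cong ((ℤ.+ 1 / suc n) *_) (a′≡0 n) ⟩
  (ℤ.+ 1 / suc n) * 0ℚ                              ≡⟨ *-zeroʳ (ℤ.+ 1 / suc n) ⟩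
  0ℚ                                                ∎

expS : PowerSeries
expS = invFact

-- coefficients of (eᶻ - 1)/z
expDiv : PowerSeries
expDiv i = invFact (suc i)

deriv-exp : ∀ n → deriv expS n ≡ expS n
deriv-exp n = begin
  fromℕ (suc n) * (invFact n * (ℤ.+ 1 / suc n))
    ≡⟨ solve 3 (λ x y z → x :* (y :* z) := y :* (z :* x)) refl (fromℕ (suc n)) (invFact n) (ℤ.+ 1 / suc n) ⟩
  invFact n * ((ℤ.+ 1 / suc n) * fromℕ (suc n))
    ≡⟨ cong (invFact n *_) (1/[1+n]*[1+n] n) ⟩
  invFact n * 1ℚ
    ≡⟨ *-identityʳ (invFact n) ⟩
  invFact n ∎

deriv-reflect-exp : ∀ n → deriv (reflect expS) n ≡ - reflect expS n
deriv-reflect-exp n = begin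
  fromℕ (suc n) * (- sign n * expS (suc n))
    ≡⟨ solve 3 (λ x y z → x :* (:- y :* z) := :- (y :* (x :* z))) refl (fromℕ (suc n)) (sign n) (expS (suc n)) ⟩
  - (sign n * deriv expS n)
    ≡⟨ cong (λ z → - (sign n * z)) (deriv-exp n) ⟩
  - reflect expS n ∎

exp⊛reflect-exp : ∀ n → (expS ⊛ reflect expS) (suc n) ≡ 0ℚ
exp⊛reflect-exp = deriv≡0⇒constant (expS ⊛ reflect expS) λ n → begin
  deriv (expS ⊛ reflect expS) n
    ≡⟨ deriv-⊛ expS (reflect expS) n ⟩
  (deriv expS ⊛ reflect expS) n + (expS ⊛ deriv (reflect expS)) n
    ≡⟨ cong₂ _+_ (⊛-congˡ (reflect expS) deriv-exp n) (⊛-congʳ expS deriv-reflect-exp n) ⟩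
  (expS ⊛ reflect expS) n + (expS ⊛ (-_ ∘ reflect expS)) n
    ≡⟨ cong ((expS ⊛ reflect expS) n +_) (⊛-negʳ expS (reflect expS) n) ⟩
  (expS ⊛ reflect expS) n + - (expS ⊛ reflect expS) n
    ≡⟨ +-inverseʳ ((expS ⊛ reflect expS) n) ⟩
  0ℚ ∎

-- reflect expDiv is (1 - e⁻ᶻ)/z, so this is eᶻ·e⁻ᶻ = 1 in disguise.
exp⊛reflect-expDiv : ∀ n → (expS ⊛ reflect expDiv) n ≡ expDiv n
exp⊛reflect-expDiv n = +-cancelˡ (- C) C (expDiv n) (trans (+-inverseˡ C) (sym (begin
  - C + expDiv n
    ≡⟨ cong₂ _+_ (sym (⊛-negʳ expS (reflect expDiv) n)) (sym (*-identityʳ (expDiv n))) ⟩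
  (expS ⊛ (-_ ∘ reflect expDiv)) n + expS (suc n) * 1ℚ
    ≡⟨ cong₂ _+_ (∑<-cong (suc n) (λ i i<1+n → cong (expS i *_) (trans (neg-distribˡ-* (sign (n ∸ i)) (invFact (suc (n ∸ i))))
           (cong (reflect expS) (sym (1+n∸i n i i<1+n))))))
         (cong (λ z → expS (suc n) * reflect expS z) (sym (ℕₚ.n∸n≡0 n))) ⟩
  ∑< (suc n) (λ i → expS i * reflect expS (suc n ∸ i)) + expS (suc n) * reflect expS (suc n ∸ suc n)
    ≡⟨ ∑<-sucʳ (suc n) (λ i → expS i * reflect expS (suc n ∸ i)) ⟨
  (expS ⊛ reflect expS) (suc n)
    ≡⟨ exp⊛reflect-exp n ⟩
  0ℚ ∎)))
  where
  C = (expS ⊛ reflect expDiv) n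

⊛-cancelʳ : ∀ x y c → c 0 ≡ 1ℚ → (∀ n → (x ⊛ c) n ≡ (y ⊛ c) n) → ∀ n → x n ≡ y n
⊛-cancelʳ x y c c₀≡1 x⊛c≡y⊛c = <-rec (λ n → x n ≡ y n) step
  where
  lead : ∀ (z : PowerSeries) n → z n ≡ z n * c (n ∸ n)
  lead z n = begin
    z n              ≡⟨ *-identityʳ (z n) ⟨
    z n * 1ℚ         ≡⟨ cong (z n *_) c₀≡1 ⟨
    z n * c 0        ≡⟨ cong (λ k → z n * c k) (ℕₚ.n∸n≡0 n) ⟨
    z n * c (n ∸ n)  ∎
  step : ∀ n → (∀ {i} → i < n → x i ≡ y i) → x n ≡ y n
  step n below = begin
    x n              ≡⟨ lead x n ⟩
    x n * c (n ∸ n)  ≡⟨ +-cancelˡ (∑< n (λ i → x i * c (n ∸ i))) _ _ (begin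
        ∑< n (λ i → x i * c (n ∸ i)) + x n * c (n ∸ n)  ≡⟨ ∑<-sucʳ n (λ i → x i * c (n ∸ i)) ⟨
        (x ⊛ c) n                                       ≡⟨ x⊛c≡y⊛c n ⟩
        (y ⊛ c) n                                       ≡⟨ ∑<-sucʳ n (λ i → y i * c (n ∸ i)) ⟩
        ∑< n (λ i → y i * c (n ∸ i)) + y n * c (n ∸ n)
          ≡⟨ cong (_+ y n * c (n ∸ n)) (∑<-cong n (λ i i<n → cong (_* c (n ∸ i)) (below i<n))) ⟨
        ∑< n (λ i → x i * c (n ∸ i)) + y n * c (n ∸ n)  ∎) ⟩
    y n * c (n ∸ n)  ≡⟨ lead y n ⟨
    y n              ∎

bernStep-∑ : ∀ m j → bernStep j (bernRev m) ≡ ∑< (suc m) (λ i → bern (m ∸ i) * invFact (suc (suc (j ℕ.+ i))))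
bernStep-∑ zero j = cong (λ z → 1ℚ * invFact (suc (suc z)) + 0ℚ) (sym (ℕₚ.+-identityʳ j))
bernStep-∑ (suc m) j = begin
  bern (suc m) * invFact (suc (suc j)) + bernStep (suc j) (bernRev m)
    ≡⟨ cong₂ _+_ (cong (λ z → bern (suc m) * invFact (suc (suc z))) (sym (ℕₚ.+-identityʳ j))) (bernStep-∑ m (suc j)) ⟩
  bern (suc m) * invFact (suc (suc (j ℕ.+ 0))) + ∑< (suc m) (λ i → bern (m ∸ i) * invFact (suc (suc (suc j ℕ.+ i))))
    ≡⟨ cong (bern (suc m) * invFact (suc (suc (j ℕ.+ 0))) +_)
         (∑<-cong (suc m) (λ i _ → cong (λ z → bern (m ∸ i) * invFact (suc (suc z))) (sym (ℕₚ.+-suc j i)))) ⟩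
  bern (suc m) * invFact (suc (suc (j ℕ.+ 0))) + ∑< (suc m) (λ i → bern (m ∸ i) * invFact (suc (suc (j ℕ.+ suc i))))
    ≡⟨ ∑<-suc (suc m) (λ i → bern (suc m ∸ i) * invFact (suc (suc (j ℕ.+ i)))) ⟨
  ∑< (suc (suc m)) (λ i → bern (suc m ∸ i) * invFact (suc (suc (j ℕ.+ i)))) ∎

expDiv⊛bern : ∀ n → (expDiv ⊛ bern) n ≡ δ₀ n
expDiv⊛bern zero = refl
expDiv⊛bern (suc m) = begin
  ∑< (suc (suc m)) (λ i → expDiv i * bern (suc m ∸ i))
    ≡⟨ ∑<-suc (suc m) (λ i → expDiv i * bern (suc m ∸ i)) ⟩
  1ℚ * bern (suc m) + ∑< (suc m) (λ i → invFact (suc (suc i)) * bern (m ∸ i))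
    ≡⟨ cong₂ _+_ (*-identityˡ (bern (suc m))) (∑<-cong (suc m) (λ i _ → *-comm (invFact (suc (suc i))) (bern (m ∸ i)))) ⟩
  - bernStep 0 (bernRev m) + ∑< (suc m) (λ i → bern (m ∸ i) * invFact (suc (suc i)))
    ≡⟨ cong (- bernStep 0 (bernRev m) +_) (bernStep-∑ m 0) ⟨
  - bernStep 0 (bernRev m) + bernStep 0 (bernRev m)
    ≡⟨ +-inverseˡ (bernStep 0 (bernRev m)) ⟩
  0ℚ ∎

reflect-δ₀ : ∀ n → reflect δ₀ n ≡ δ₀ n
reflect-δ₀ zero = refl
reflect-δ₀ (suc n) = *-zeroʳ (sign (suc n))

-- Both sides become 1 after multiplication by the invertible series (1 - e⁻ᶻ)/z.
exp⊛bern : ∀ n → (expS ⊛ bern) n ≡ reflect bern n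
exp⊛bern = ⊛-cancelʳ (expS ⊛ bern) (reflect bern) (reflect expDiv) refl λ n → begin
  ((expS ⊛ bern) ⊛ reflect expDiv) n    ≡⟨ ⊛-congˡ (reflect expDiv) (⊛-comm expS bern) n ⟩
  ((bern ⊛ expS) ⊛ reflect expDiv) n    ≡⟨ ⊛-assoc bern expS (reflect expDiv) n ⟩
  (bern ⊛ (expS ⊛ reflect expDiv)) n    ≡⟨ ⊛-congʳ bern exp⊛reflect-expDiv n ⟩
  (bern ⊛ expDiv) n                     ≡⟨ ⊛-comm bern expDiv n ⟩
  (expDiv ⊛ bern) n                     ≡⟨ expDiv⊛bern n ⟩
  δ₀ n                                  ≡⟨ reflect-δ₀ n ⟨
  reflect δ₀ n                          ≡⟨ cong (sign n *_) (trans (⊛-comm bern expDiv n) (expDiv⊛bern n)) ⟨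
  reflect (bern ⊛ expDiv) n             ≡⟨ reflect-⊛ bern expDiv n ⟨
  (reflect bern ⊛ reflect expDiv) n     ∎

exp⊛bern-suc : ∀ m → (expS ⊛ bern) (suc m) ≡ bern (suc m) + δ₀ m
exp⊛bern-suc m = begin
  (expS ⊛ bern) (suc m)                ≡⟨ ∑<-suc (suc m) (λ i → expS i * bern (suc m ∸ i)) ⟩
  1ℚ * bern (suc m) + (expDiv ⊛ bern) m ≡⟨ cong₂ _+_ (*-identityˡ (bern (suc m))) (expDiv⊛bern m) ⟩
  bern (suc m) + δ₀ m                  ∎

sign-isOdd : ∀ n → sign n ≡ (if isOdd n then - 1ℚ else 1ℚ)
sign-isOdd zero = refl
sign-isOdd (suc n) with isOdd n | sign-isOdd n
... | true | s≡ = cong -_ s≡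
... | false | s≡ = cong -_ s≡

x≡-x⇒x≡0 : ∀ x → x ≡ - x → x ≡ 0ℚ
x≡-x⇒x≡0 x x≡-x = begin
  x                               ≡⟨ solve 2 (λ x h → x := (x :+ x) :* h :+ x :* (con 1ℚ :- (h :+ h))) refl x ½ ⟩
  (x + x) * ½ + x * (1ℚ - (½ + ½)) ≡⟨ cong (λ z → (x + z) * ½ + x * (1ℚ - (½ + ½))) x≡-x ⟩
  (x + - x) * ½ + x * 0ℚ           ≡⟨ cong₂ (λ u v → u * ½ + v) (+-inverseʳ x) (*-zeroʳ x) ⟩
  0ℚ * ½ + 0ℚ                      ≡⟨⟩
  0ℚ                               ∎
  where
  ½ = ℤ.+ 1 / 2

bern-odd : ∀ m → fertOK m ≡ false → bern m ≡ 0ℚ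
bern-odd (suc (suc (suc j))) odd = x≡-x⇒x≡0 (bern m) (begin
  bern m                    ≡⟨ +-identityʳ (bern m) ⟨
  bern m + δ₀ (suc (suc j)) ≡⟨ exp⊛bern-suc (suc (suc j)) ⟨
  (expS ⊛ bern) m           ≡⟨ exp⊛bern m ⟩
  sign m * bern m           ≡⟨ cong (_* bern m) (sign-isOdd m) ⟩
  (if isOdd m then - 1ℚ else 1ℚ) * bern m ≡⟨ cong (λ b → (if b then - 1ℚ else 1ℚ) * bern m) (isOdd≡true odd) ⟩
  - 1ℚ * bern m             ≡⟨ neg-distribˡ-* 1ℚ (bern m) ⟨
  - (1ℚ * bern m)           ≡⟨ cong -_ (*-identityˡ (bern m)) ⟩
  - bern m                  ∎)
  where
  m = suc (suc (suc j))
  isOdd≡true : not (isOdd m) ≡ false → isOdd m ≡ true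
  isOdd≡true with isOdd m
  ... | true = λ _ → refl
  ... | false = λ ()

-- Canonical forms of rooted trees

lex : Ord3 → Ord3 → Ord3
lex lt _ = lt
lex eq r = r
lex gt _ = gt

flipOrd : Ord3 → Ord3
flipOrd lt = gt
flipOrd eq = eq
flipOrd gt = lt

cmpF-∷ : ∀ x xs y ys → cmpF (x ∷ xs) (y ∷ ys) ≡ lex (cmp x y) (cmpF xs ys)
cmpF-∷ x xs y ys with cmp x y
... | lt = refl
... | eq = refl
... | gt = refl

lex-eq : ∀ c r → lex c r ≡ eq → c ≡ eq × r ≡ eq
lex-eq eq r e = refl , e

data LexLt : Ord3 → Ord3 → Set where
  first : ∀ {r} → LexLt lt r
  second : LexLt eq lt

lex-lt : ∀ c r → lex c r ≡ lt → LexLt c r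
lex-lt lt r e = first
lex-lt eq lt e = second

lex-flip : ∀ c r → lex (flipOrd c) (flipOrd r) ≡ flipOrd (lex c r)
lex-flip lt r = refl
lex-flip eq r = refl
lex-flip gt r = refl

mutual
  cmp-refl : ∀ x → cmp x x ≡ eq
  cmp-refl (node xs) = cmpF-refl xs

  cmpF-refl : ∀ xs → cmpF xs xs ≡ eq
  cmpF-refl [] = refl
  cmpF-refl (x ∷ xs) = begin
    cmpF (x ∷ xs) (x ∷ xs)      ≡⟨ cmpF-∷ x xs x xs ⟩
    lex (cmp x x) (cmpF xs xs)  ≡⟨ cong₂ lex (cmp-refl x) (cmpF-refl xs) ⟩
    eq                          ∎

mutual
  cmp-eq⇒≡ : ∀ x y → cmp x y ≡ eq → x ≡ y
  cmp-eq⇒≡ (node xs) (node ys) e = cong node (cmpF-eq⇒≡ xs ys e)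

  cmpF-eq⇒≡ : ∀ xs ys → cmpF xs ys ≡ eq → xs ≡ ys
  cmpF-eq⇒≡ [] [] e = refl
  cmpF-eq⇒≡ (x ∷ xs) (y ∷ ys) e with lex-eq (cmp x y) (cmpF xs ys) (trans (sym (cmpF-∷ x xs y ys)) e)
  ... | e₁ , e₂ = cong₂ _∷_ (cmp-eq⇒≡ x y e₁) (cmpF-eq⇒≡ xs ys e₂)

mutual
  cmp-flip : ∀ x y → cmp y x ≡ flipOrd (cmp x y)
  cmp-flip (node xs) (node ys) = cmpF-flip xs ys

  cmpF-flip : ∀ xs ys → cmpF ys xs ≡ flipOrd (cmpF xs ys)
  cmpF-flip [] [] = refl
  cmpF-flip [] (y ∷ ys) = refl
  cmpF-flip (x ∷ xs) [] = refl
  cmpF-flip (x ∷ xs) (y ∷ ys) = begin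
    cmpF (y ∷ ys) (x ∷ xs)                          ≡⟨ cmpF-∷ y ys x xs ⟩
    lex (cmp y x) (cmpF ys xs)                      ≡⟨ cong₂ lex (cmp-flip x y) (cmpF-flip xs ys) ⟩
    lex (flipOrd (cmp x y)) (flipOrd (cmpF xs ys))  ≡⟨ lex-flip (cmp x y) (cmpF xs ys) ⟩
    flipOrd (lex (cmp x y) (cmpF xs ys))            ≡⟨ cong flipOrd (sym (cmpF-∷ x xs y ys)) ⟩
    flipOrd (cmpF (x ∷ xs) (y ∷ ys))                ∎

mutual
  cmp-trans : ∀ x y z → cmp x y ≡ lt → cmp y z ≡ lt → cmp x z ≡ lt
  cmp-trans (node xs) (node ys) (node zs) = cmpF-trans xs ys zs

  cmpF-trans : ∀ xs ys zs → cmpF xs ys ≡ lt → cmpF ys zs ≡ lt → cmpF xs zs ≡ lt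
  cmpF-trans [] (y ∷ ys) (z ∷ zs) _ _ = refl
  cmpF-trans (x ∷ xs) (y ∷ ys) (z ∷ zs) xy yz =
    trans (cmpF-∷ x xs z zs)
      (lexTrans (cmp x y) (cmpF xs ys) (cmp y z) (cmpF ys zs) refl refl refl refl
         (lex-lt _ _ (trans (sym (cmpF-∷ x xs y ys)) xy))
         (lex-lt _ _ (trans (sym (cmpF-∷ y ys z zs)) yz)))
    where
    lexTrans : ∀ c₁ r₁ c₂ r₂ → cmp x y ≡ c₁ → cmpF xs ys ≡ r₁ → cmp y z ≡ c₂ → cmpF ys zs ≡ r₂ →
               LexLt c₁ r₁ → LexLt c₂ r₂ → lex (cmp x z) (cmpF xs zs) ≡ lt
    lexTrans _ _ _ _ a _ c _ first first rewrite cmp-trans x y z a c = refl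
    lexTrans _ _ _ _ a _ c _ first second rewrite cmp-eq⇒≡ y z c | a = refl
    lexTrans _ _ _ _ a _ c _ second first rewrite cmp-eq⇒≡ x y a | c = refl
    lexTrans _ _ _ _ a b c d second second rewrite cmp-eq⇒≡ x y a | cmp-eq⇒≡ y z c | cmp-refl z =
      cmpF-trans xs ys zs b d

notGt : Ord3 → Bool
notGt gt = false
notGt _ = true

isEq : Ord3 → Bool
isEq eq = true
isEq _ = false

leq-cmp : ∀ x y → leq x y ≡ notGt (cmp x y)
leq-cmp x y with cmp x y
... | lt = refl
... | eq = refl
... | gt = refl

eqT-cmp : ∀ x y → eqT x y ≡ isEq (cmp x y)
eqT-cmp x y with cmp x y
... | lt = refl
... | eq = refl
... | gt = refl

leq-total : ∀ x y → leq x y ≡ false → leq y x ≡ false → ⊥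
leq-total x y rewrite leq-cmp x y | leq-cmp y x | cmp-flip x y with cmp x y
... | gt = λ _ ()

leq-antisym : ∀ x y → leq x y ≡ true → leq y x ≡ true → x ≡ y
leq-antisym x y rewrite leq-cmp x y | leq-cmp y x | cmp-flip x y with cmp x y in e
... | eq = λ _ _ → cmp-eq⇒≡ x y e
... | lt = λ _ ()
... | gt = λ ()

leq-trans : ∀ x y z → leq x y ≡ true → leq y z ≡ true → leq x z ≡ true
leq-trans x y z rewrite leq-cmp x y | leq-cmp y z | leq-cmp x z with cmp x y in xy | cmp y z in yz
... | lt | lt rewrite cmp-trans x y z xy yz = λ _ _ → refl
... | lt | eq rewrite cmp-eq⇒≡ y z yz | xy = λ _ _ → refl
... | eq | _ rewrite cmp-eq⇒≡ x y xy | yz = λ _ yz≤ → yz≤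
... | lt | gt = λ _ ()
... | gt | _ = λ ()

eqT⇒≡ : ∀ x y → eqT x y ≡ true → x ≡ y
eqT⇒≡ x y rewrite eqT-cmp x y with cmp x y in e
... | eq = λ _ → cmp-eq⇒≡ x y e
... | lt = λ ()
... | gt = λ ()

eqT-refl : ∀ x → eqT x x ≡ true
eqT-refl x rewrite eqT-cmp x x | cmp-refl x = refl

eqT-sym : ∀ x y → eqT x y ≡ eqT y x
eqT-sym x y rewrite eqT-cmp x y | eqT-cmp y x | cmp-flip x y with cmp x y
... | lt = refl
... | eq = refl
... | gt = refl

true≢false : true ≡ false → ⊥
true≢false ()

insert-comm : ∀ a b l → insert a (insert b l) ≡ insert b (insert a l)
insert-comm a b [] with leq a b in ab | leq b a in ba
... | true | true rewrite leq-antisym a b ab ba = refl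
... | true | false = refl
... | false | true = refl
... | false | false = ⊥-elim (leq-total a b ab ba)
insert-comm a b (y ∷ ys) with leq b y in by | leq a y in ay
... | true | true with leq a b in ab | leq b a in ba
...   | true | true rewrite leq-antisym a b ab ba = refl
...   | true | false rewrite by = refl
...   | false | true rewrite ay = refl
...   | false | false = ⊥-elim (leq-total a b ab ba)
insert-comm a b (y ∷ ys) | true | false with leq a b in ab
...   | true = ⊥-elim (true≢false (trans (sym (leq-trans a b y ab by)) ay))
...   | false rewrite ay | by = refl
insert-comm a b (y ∷ ys) | false | true with leq b a in ba
...   | true = ⊥-elim (true≢false (trans (sym (leq-trans b a y ba ay)) by))
...   | false rewrite ay | by = refl
insert-comm a b (y ∷ ys) | false | false rewrite ay | by = cong (y ∷_) (insert-comm a b ys)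

data Iso : PTree → PTree → Set
data LIso : List PTree → List PTree → Set

data Iso where
  node : ∀ {ts ts'} → LIso ts ts' → Iso (node ts) (node ts')

data LIso where
  [] : LIso [] []
  _∷_ : ∀ {t t' ts ts'} → Iso t t' → LIso ts ts' → LIso (t ∷ ts) (t' ∷ ts')
  swap : ∀ t u ts → LIso (t ∷ u ∷ ts) (u ∷ t ∷ ts)
  _⨾_ : ∀ {ts ts' ts''} → LIso ts ts' → LIso ts' ts'' → LIso ts ts''

mutual
  Iso-refl : ∀ t → Iso t t
  Iso-refl (node ts) = node (LIso-refl ts)

  LIso-refl : ∀ ts → LIso ts ts
  LIso-refl [] = []
  LIso-refl (t ∷ ts) = Iso-refl t ∷ LIso-refl ts

mutual
  Iso-sym : ∀ {t t'} → Iso t t' → Iso t' t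
  Iso-sym (node p) = node (LIso-sym p)

  LIso-sym : ∀ {ts ts'} → LIso ts ts' → LIso ts' ts
  LIso-sym [] = []
  LIso-sym (i ∷ p) = Iso-sym i ∷ LIso-sym p
  LIso-sym (swap t u ts) = swap u t ts
  LIso-sym (p ⨾ q) = LIso-sym q ⨾ LIso-sym p

mutual
  Iso⇒canon≡ : ∀ {t t'} → Iso t t' → canon t ≡ canon t'
  Iso⇒canon≡ (node p) = cong node (LIso⇒sort≡ p)

  LIso⇒sort≡ : ∀ {ts ts'} → LIso ts ts' → sortT (canonF ts) ≡ sortT (canonF ts')
  LIso⇒sort≡ [] = refl
  LIso⇒sort≡ (i ∷ p) = cong₂ insert (Iso⇒canon≡ i) (LIso⇒sort≡ p)
  LIso⇒sort≡ (swap t u ts) = insert-comm (canon t) (canon u) (sortT (canonF ts))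
  LIso⇒sort≡ (p ⨾ q) = trans (LIso⇒sort≡ p) (LIso⇒sort≡ q)

mutual
  Iso⇒size≡ : ∀ {t t'} → Iso t t' → size t ≡ size t'
  Iso⇒size≡ (node p) = cong suc (LIso⇒sizeF≡ p)

  LIso⇒sizeF≡ : ∀ {ts ts'} → LIso ts ts' → sizeF ts ≡ sizeF ts'
  LIso⇒sizeF≡ [] = refl
  LIso⇒sizeF≡ (i ∷ p) = cong₂ ℕ._+_ (Iso⇒size≡ i) (LIso⇒sizeF≡ p)
  LIso⇒sizeF≡ (swap t u ts) = +-leftComm (size t) (size u) (sizeF ts)
  LIso⇒sizeF≡ (p ⨾ q) = trans (LIso⇒sizeF≡ p) (LIso⇒sizeF≡ q)

Iso-trans : ∀ {a b c} → Iso a b → Iso b c → Iso a c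
Iso-trans (node p) (node q) = node (p ⨾ q)

insert-LIso : ∀ x l → LIso (x ∷ l) (insert x l)
insert-LIso x [] = LIso-refl _
insert-LIso x (y ∷ ys) with leq x y
... | true = LIso-refl _
... | false = swap x y ys ⨾ (Iso-refl y ∷ insert-LIso x ys)

sort-LIso : ∀ l → LIso l (sortT l)
sort-LIso [] = []
sort-LIso (x ∷ l) = (Iso-refl x ∷ sort-LIso l) ⨾ insert-LIso x (sortT l)

mutual
  Iso-canon : ∀ t → Iso t (canon t)
  Iso-canon (node ts) = node (LIso-canonF ts ⨾ sort-LIso (canonF ts))

  LIso-canonF : ∀ ts → LIso ts (canonF ts)
  LIso-canonF [] = []
  LIso-canonF (t ∷ ts) = Iso-canon t ∷ LIso-canonF ts

canon-idem : ∀ t → canon (canon t) ≡ canon t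
canon-idem t = Iso⇒canon≡ (Iso-sym (Iso-canon t))

size-canon : ∀ t → size (canon t) ≡ size t
size-canon t = sym (Iso⇒size≡ (Iso-canon t))

sameTree⇒canon≡ : ∀ s t → sameTree s t ≡ true → canon s ≡ canon t
sameTree⇒canon≡ s t = eqT⇒≡ (canon s) (canon t)

sameTree-sym : ∀ s t → sameTree s t ≡ sameTree t s
sameTree-sym s t = eqT-sym (canon s) (canon t)

sameTree⇒size≡ : ∀ s t → sameTree s t ≡ true → size s ≡ size t
sameTree⇒size≡ s t e = begin
  size s          ≡⟨ size-canon s ⟨
  size (canon s)  ≡⟨ cong size (sameTree⇒canon≡ s t e) ⟩
  size (canon t)  ≡⟨ size-canon t ⟩
  size t          ∎

isCanonical-canon : ∀ t → isCanonical (canon t) ≡ true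
isCanonical-canon t rewrite canon-idem t = eqT-refl (canon t)

isCanonical⇒canon≡ : ∀ t → isCanonical t ≡ true → canon t ≡ t
isCanonical⇒canon≡ t = eqT⇒≡ (canon t) t

size≥1 : ∀ t → 1 ≤ size t
size≥1 (node ts) = s≤s z≤n

mapUpTo-cong : ∀ {A : Set} n {g h : ℕ → A} → (∀ k → k < n → g k ≡ h k) → map g (upTo n) ≡ map h (upTo n)
mapUpTo-cong n e = List.map-cong-local (All.map (λ {k} → e k) (upTo-< n))

mutual
  treesF-fuel : ∀ f n → n ≤ f → treesF (suc f) n ≡ treesF f n
  treesF-fuel zero zero _ = refl
  treesF-fuel (suc f) zero _ = refl
  treesF-fuel (suc f) (suc n) (s≤s n≤f) = cong (map node) (forestsF-fuel f n n≤f)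

  forestsF-fuel : ∀ f n → n ≤ f → forestsF (suc f) n ≡ forestsF f n
  forestsF-fuel f zero _ = refl
  forestsF-fuel (suc f) (suc n) (s≤s n≤f) = cong concat (mapUpTo-cong (suc n) λ k k<1+n →
    cong₂ (λ ts fs → concatMap (λ t → map (t ∷_) fs) ts)
      (treesF-fuel (suc f) (suc k) (ℕₚ.≤-trans k<1+n (s≤s n≤f)))
      (forestsF-fuel f (n ∸ k) (ℕₚ.≤-trans (ℕₚ.m∸n≤m n k) n≤f)))

treesF≡planarTrees : ∀ f n → n ≤ f → treesF f n ≡ planarTrees n
treesF≡planarTrees f n n≤f = trans (cong (λ z → treesF z n) (sym (ℕₚ.m∸n+n≡m n≤f))) (by (f ∸ n))
  where
  by : ∀ d → treesF (d ℕ.+ n) n ≡ treesF n n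
  by zero = refl
  by (suc d) = trans (treesF-fuel (d ℕ.+ n) n (ℕₚ.m≤n+m n d)) (by d)

concatMap-All : ∀ {A B : Set} {Q : A → Set} {P : B → Set} (h : A → List B) {xs} →
  All Q xs → (∀ x → Q x → All P (h x)) → All P (concatMap h xs)
concatMap-All h [] ph = []
concatMap-All h (qx ∷ qxs) ph = All.++⁺ (ph _ qx) (concatMap-All h qxs ph)

mutual
  treesF-size : ∀ f n → All (λ t → size t ≡ n) (treesF f n)
  treesF-size zero n = []
  treesF-size (suc f) zero = []
  treesF-size (suc f) (suc n) = All.map⁺ (All.map (cong suc) (forestsF-size f n))

  forestsF-size : ∀ f n → All (λ ts → sizeF ts ≡ n) (forestsF f n)
  forestsF-size f zero = refl ∷ []
  forestsF-size zero (suc n) = []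
  forestsF-size (suc f) (suc n) = concatMap-All _ (upTo-< (suc n)) λ k k<1+n →
    concatMap-All _ (treesF-size (suc f) (suc k)) λ t t≡ →
      All.map⁺ (All.map (λ ts≡ → trans (cong₂ ℕ._+_ t≡ ts≡) (cong suc (ℕₚ.m+[n∸m]≡n (ℕₚ.≤-pred k<1+n))))
                        (forestsF-size f (n ∸ k)))

∑-forestsF : ∀ f n (g : List PTree → ℚ) → ∑ g (forestsF (suc f) (suc n)) ≡
  ∑< (suc n) (λ k → ∑ (λ t → ∑ (λ ts → g (t ∷ ts)) (forestsF f (n ∸ k))) (treesF (suc f) (suc k)))
∑-forestsF f n g =
  trans (∑-concatMap g (λ k → concatMap (λ t → map (t ∷_) (forestsF f (n ∸ k))) (treesF (suc f) (suc k))) (upTo (suc n)))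
        (∑-cong (λ k →
  trans (∑-concatMap g (λ t → map (t ∷_) (forestsF f (n ∸ k))) (treesF (suc f) (suc k)))
        (∑-cong (λ t → ∑-map g (t ∷_) (forestsF f (n ∸ k))) (treesF (suc f) (suc k)))) (upTo (suc n)))

≡ᵇ-sym : ∀ a b → (a ≡ᵇ b) ≡ (b ≡ᵇ a)
≡ᵇ-sym zero zero = refl
≡ᵇ-sym zero (suc b) = refl
≡ᵇ-sym (suc a) zero = refl
≡ᵇ-sym (suc a) (suc b) = ≡ᵇ-sym a b

<ᵇ∧≡ᵇ∸ : ∀ a b n → ((a <ᵇ suc n) ∧ (b ≡ᵇ n ∸ a)) ≡ (a ℕ.+ b ≡ᵇ n)
<ᵇ∧≡ᵇ∸ zero b n = refl
<ᵇ∧≡ᵇ∸ (suc a) b zero = refl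
<ᵇ∧≡ᵇ∸ (suc a) b (suc n) = <ᵇ∧≡ᵇ∸ a b n

∑<-splitting : ∀ a b n v → ∑< (suc n) (λ k → when (a ≡ᵇ k) (when (b ≡ᵇ n ∸ k) v)) ≡ when (a ℕ.+ b ≡ᵇ n) v
∑<-splitting a b n v = begin
  ∑< (suc n) (λ k → when (a ≡ᵇ k) (when (b ≡ᵇ n ∸ k) v))
    ≡⟨ ∑<-cong (suc n) (λ k _ → cong (λ c → when c (when (b ≡ᵇ n ∸ k) v)) (≡ᵇ-sym a k)) ⟩
  ∑< (suc n) (λ k → when (k ≡ᵇ a) (when (b ≡ᵇ n ∸ k) v))
    ≡⟨ ∑<-indicator (suc n) a (λ k → when (b ≡ᵇ n ∸ k) v) ⟩
  when (a <ᵇ suc n) (when (b ≡ᵇ n ∸ a) v)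
    ≡⟨ when-∧ (a <ᵇ suc n) (b ≡ᵇ n ∸ a) v ⟨
  when ((a <ᵇ suc n) ∧ (b ≡ᵇ n ∸ a)) v
    ≡⟨ cong (λ c → when c v) (<ᵇ∧≡ᵇ∸ a b n) ⟩
  when (a ℕ.+ b ≡ᵇ n) v ∎

eqF : List PTree → List PTree → Bool
eqF xs ys = isEq (cmpF xs ys)

isEq-lex : ∀ c r → isEq (lex c r) ≡ isEq c ∧ isEq r
isEq-lex lt r = refl
isEq-lex eq r = refl
isEq-lex gt r = refl

eqF-∷ : ∀ x xs y ys → eqF (x ∷ xs) (y ∷ ys) ≡ eqT x y ∧ eqF xs ys
eqF-∷ x xs y ys = begin
  isEq (cmpF (x ∷ xs) (y ∷ ys))          ≡⟨ cong isEq (cmpF-∷ x xs y ys) ⟩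
  isEq (lex (cmp x y) (cmpF xs ys))      ≡⟨ isEq-lex (cmp x y) (cmpF xs ys) ⟩
  isEq (cmp x y) ∧ eqF xs ys             ≡⟨ cong (_∧ eqF xs ys) (eqT-cmp x y) ⟨
  eqT x y ∧ eqF xs ys                    ∎

mutual
  ∑-treesF-eqT : ∀ f n c (v : PTree → ℚ) → n ≤ f →
    ∑ (λ t → when (eqT c t) (v t)) (treesF f n) ≡ when (size c ≡ᵇ n) (v c)
  ∑-treesF-eqT zero zero (node cs) v _ = refl
  ∑-treesF-eqT (suc f) zero (node cs) v _ = refl
  ∑-treesF-eqT (suc f) (suc n) (node cs) v (s≤s n≤f) = begin
    ∑ (λ t → when (eqT (node cs) t) (v t)) (map node (forestsF f n))
      ≡⟨ ∑-map _ node (forestsF f n) ⟩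
    ∑ (λ ts → when (eqT (node cs) (node ts)) (v (node ts))) (forestsF f n)
      ≡⟨ ∑-cong (λ ts → cong (λ b → when b (v (node ts))) (eqT-cmp (node cs) (node ts))) (forestsF f n) ⟩
    ∑ (λ ts → when (eqF cs ts) (v (node ts))) (forestsF f n)
      ≡⟨ ∑-forestsF-eqF f n cs (v ∘ node) n≤f ⟩
    when (sizeF cs ≡ᵇ n) (v (node cs)) ∎

  ∑-forestsF-eqF : ∀ f n cs (w : List PTree → ℚ) → n ≤ f →
    ∑ (λ ts → when (eqF cs ts) (w ts)) (forestsF f n) ≡ when (sizeF cs ≡ᵇ n) (w cs)
  ∑-forestsF-eqF f zero [] w _ = +-identityʳ (w [])
  ∑-forestsF-eqF f zero (node c ∷ cs) w _ = +-identityʳ 0ℚ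
  ∑-forestsF-eqF (suc f) (suc n) [] w _ =
    trans (∑-forestsF f n (λ ts → when (eqF [] ts) (w ts)))
          (∑<-zero (suc n) (λ k _ → ∑-zero (λ t → ∑-zero (λ _ → refl) (forestsF f (n ∸ k))) (treesF (suc f) (suc k))))
  ∑-forestsF-eqF (suc f) (suc n) (node c ∷ cs) w (s≤s n≤f) = begin
    ∑ (λ ts → when (eqF (node c ∷ cs) ts) (w ts)) (forestsF (suc f) (suc n))
      ≡⟨ ∑-forestsF f n (λ ts → when (eqF (node c ∷ cs) ts) (w ts)) ⟩
    ∑< (suc n) (λ k → ∑ (λ t → ∑ (λ ts → when (eqF (node c ∷ cs) (t ∷ ts)) (w (t ∷ ts))) (forestsF f (n ∸ k))) (treesF (suc f) (suc k)))
      ≡⟨ ∑<-cong (suc n) (λ k k<1+n → ∑-cong (λ t → tail k t) (treesF (suc f) (suc k))) ⟩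
    ∑< (suc n) (λ k → ∑ (λ t → when (eqT (node c) t) (when (sizeF cs ≡ᵇ n ∸ k) (w (t ∷ cs)))) (treesF (suc f) (suc k)))
      ≡⟨ ∑<-cong (suc n) (λ k k<1+n → ∑-treesF-eqT (suc f) (suc k) (node c) _ (ℕₚ.≤-trans k<1+n (s≤s n≤f))) ⟩
    ∑< (suc n) (λ k → when (sizeF c ≡ᵇ k) (when (sizeF cs ≡ᵇ n ∸ k) (w (node c ∷ cs))))
      ≡⟨ ∑<-splitting (sizeF c) (sizeF cs) n (w (node c ∷ cs)) ⟩
    when (sizeF c ℕ.+ sizeF cs ≡ᵇ n) (w (node c ∷ cs)) ∎
    where
    tail : ∀ k t → ∑ (λ ts → when (eqF (node c ∷ cs) (t ∷ ts)) (w (t ∷ ts))) (forestsF f (n ∸ k))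
                 ≡ when (eqT (node c) t) (when (sizeF cs ≡ᵇ n ∸ k) (w (t ∷ cs)))
    tail k t = begin
      ∑ (λ ts → when (eqF (node c ∷ cs) (t ∷ ts)) (w (t ∷ ts))) (forestsF f (n ∸ k))
        ≡⟨ ∑-cong (λ ts → trans (cong (λ b → when b (w (t ∷ ts))) (eqF-∷ (node c) cs t ts))
                                (when-∧ (eqT (node c) t) (eqF cs ts) (w (t ∷ ts)))) (forestsF f (n ∸ k)) ⟩
      ∑ (λ ts → when (eqT (node c) t) (when (eqF cs ts) (w (t ∷ ts)))) (forestsF f (n ∸ k))
        ≡⟨ ∑-when (eqT (node c) t) _ (forestsF f (n ∸ k)) ⟩
      when (eqT (node c) t) (∑ (λ ts → when (eqF cs ts) (w (t ∷ ts))) (forestsF f (n ∸ k)))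
        ≡⟨ cong (when (eqT (node c) t)) (∑-forestsF-eqF f (n ∸ k) cs (λ ts → w (t ∷ ts)) (ℕₚ.≤-trans (ℕₚ.m∸n≤m n k) n≤f)) ⟩
      when (eqT (node c) t) (when (sizeF cs ≡ᵇ n ∸ k) (w (t ∷ cs))) ∎

∑-nonPlanarTrees-sameTree : ∀ k s (v : PTree → ℚ) →
  ∑ (λ t → when (sameTree s t) (v t)) (nonPlanarTrees k) ≡ when (size s ≡ᵇ k) (v (canon s))
∑-nonPlanarTrees-sameTree k s v = begin
  ∑ (λ t → when (sameTree s t) (v t)) (nonPlanarTrees k)
    ≡⟨ ∑-filter isCanonical _ (planarTrees k) ⟩
  ∑ (λ t → when (isCanonical t) (when (sameTree s t) (v t))) (planarTrees k)
    ≡⟨ ∑-cong canonical-sameTree (planarTrees k) ⟩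
  ∑ (λ t → when (eqT (canon s) t) (v t)) (treesF k k)
    ≡⟨ ∑-treesF-eqT k k (canon s) v ℕₚ.≤-refl ⟩
  when (size (canon s) ≡ᵇ k) (v (canon s))
    ≡⟨ cong (λ z → when (z ≡ᵇ k) (v (canon s))) (size-canon s) ⟩
  when (size s ≡ᵇ k) (v (canon s)) ∎
  where
  canonical-sameTree : ∀ t → when (isCanonical t) (when (sameTree s t) (v t)) ≡ when (eqT (canon s) t) (v t)
  canonical-sameTree t with eqT (canon s) t in e
  ... | true rewrite sym (eqT⇒≡ (canon s) t e) | isCanonical-canon s | canon-idem s | eqT-refl (canon s) = refl
  ... | false with isCanonical t in c
  ...   | false = refl
  ...   | true rewrite isCanonical⇒canon≡ t c | e = refl

∑T≤ : ℕ → (PTree → ℚ) → ℚ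
∑T≤ M h = ∑< (suc M) (λ k → ∑ h (nonPlanarTrees k))

∑T≤-cong : ∀ M {g h : PTree → ℚ} → (∀ t → g t ≡ h t) → ∑T≤ M g ≡ ∑T≤ M h
∑T≤-cong M e = ∑-cong (λ k → ∑-cong e (nonPlanarTrees k)) (upTo (suc M))

∑T≤-zero : ∀ M {h : PTree → ℚ} → (∀ t → h t ≡ 0ℚ) → ∑T≤ M h ≡ 0ℚ
∑T≤-zero M e = ∑<-zero (suc M) (λ k _ → ∑-zero e (nonPlanarTrees k))

IsClassFunction : (PTree → ℚ) → Set
IsClassFunction φ = ∀ t → φ (canon t) ≡ φ t

VanishesAbove : ℕ → (PTree → ℚ) → Set
VanishesAbove M φ = ∀ t → M < size t → φ t ≡ 0ℚ

∑T≤-sameTree : ∀ M t (φ : PTree → ℚ) → IsClassFunction φ → VanishesAbove M φ →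
  ∑T≤ M (λ u → when (sameTree t u) (φ u)) ≡ φ t
∑T≤-sameTree M t φ class vanish = begin
  ∑< (suc M) (λ k → ∑ (λ u → when (sameTree t u) (φ u)) (nonPlanarTrees k))
    ≡⟨ ∑<-cong (suc M) (λ k _ → trans (∑-nonPlanarTrees-sameTree k t φ) (cong (λ c → when c (φ (canon t))) (≡ᵇ-sym (size t) k))) ⟩
  ∑< (suc M) (λ k → when (k ≡ᵇ size t) (φ (canon t)))
    ≡⟨ ∑<-indicator (suc M) (size t) (λ _ → φ (canon t)) ⟩
  when (size t <ᵇ suc M) (φ (canon t))
    ≡⟨ inRange ⟩
  φ t ∎
  where
  inRange : when (size t <ᵇ suc M) (φ (canon t)) ≡ φ t
  inRange with size t <ᵇ suc M in e
  ... | true = class t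
  ... | false = sym (vanish t (ℕₚ.≰⇒> λ t≤M → subst T e (ℕₚ.<⇒<ᵇ (s≤s t≤M))))

pairing : Lin → (PTree → ℚ) → ℚ
pairing y φ = ∑ (λ p → proj₁ p * φ (proj₂ p)) y

pairing-coefL : ∀ M (φ : PTree → ℚ) → IsClassFunction φ → VanishesAbove M φ →
  ∀ y → pairing y φ ≡ ∑T≤ M (λ t → coefL t y * φ t)
pairing-coefL M φ class vanish y = sym (begin
  ∑< (suc M) (λ k → ∑ (λ t → coefL t y * φ t) (nonPlanarTrees k))
    ≡⟨ ∑<-cong (suc M) (λ k _ → ∑-cong (λ t → ∑-*ʳ (φ t) _ y) (nonPlanarTrees k)) ⟩
  ∑< (suc M) (λ k → ∑ (λ t → ∑ (λ p → term p t) y) (nonPlanarTrees k))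
    ≡⟨ ∑<-cong (suc M) (λ k _ → ∑-comm (λ t p → term p t) (nonPlanarTrees k) y) ⟩
  ∑< (suc M) (λ k → ∑ (λ p → ∑ (term p) (nonPlanarTrees k)) y)
    ≡⟨ ∑-comm (λ k p → ∑ (term p) (nonPlanarTrees k)) (upTo (suc M)) y ⟩
  ∑ (λ p → ∑T≤ M (term p)) y
    ≡⟨ ∑-cong single y ⟩
  pairing y φ ∎)
  where
  term : ℚ × PTree → PTree → ℚ
  term (q , u) t = when (sameTree t u) q * φ t
  single : ∀ p → ∑T≤ M (term p) ≡ proj₁ p * φ (proj₂ p)
  single (q , u) = begin
    ∑T≤ M (λ t → when (sameTree t u) q * φ t)
      ≡⟨ ∑T≤-cong M (λ t → trans (when-*ʳ (sameTree t u) q (φ t)) (cong (λ c → when c (q * φ t)) (sameTree-sym t u))) ⟩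
    ∑T≤ M (λ t → when (sameTree u t) (q * φ t))
      ≡⟨ ∑T≤-sameTree M u (λ t → q * φ t) (λ t → cong (q *_) (class t)) (λ t lt → trans (cong (q *_) (vanish t lt)) (*-zeroʳ q)) ⟩
    q * φ u ∎

coefL-trunc : ∀ n (X : Series) s → coefL s (trunc n X) ≡ when (size s <ᵇ suc n) (X (canon s))
coefL-trunc n X s = begin
  coefL s (trunc n X)
    ≡⟨ ∑-concatMap _ (λ k → map (λ t → (X t , t)) (nonPlanarTrees k)) (upTo (suc n)) ⟩
  ∑< (suc n) (λ k → ∑ (λ p → when (sameTree s (proj₂ p)) (proj₁ p)) (map (λ t → (X t , t)) (nonPlanarTrees k)))
    ≡⟨ ∑<-cong (suc n) (λ k _ → trans (∑-map _ (λ t → (X t , t)) (nonPlanarTrees k)) (∑-nonPlanarTrees-sameTree k s X)) ⟩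
  ∑< (suc n) (λ k → when (size s ≡ᵇ k) (X (canon s)))
    ≡⟨ ∑<-cong (suc n) (λ k _ → cong (λ c → when c (X (canon s))) (≡ᵇ-sym (size s) k)) ⟩
  ∑< (suc n) (λ k → when (k ≡ᵇ size s) (X (canon s)))
    ≡⟨ ∑<-indicator (suc n) (size s) (λ _ → X (canon s)) ⟩
  when (size s <ᵇ suc n) (X (canon s)) ∎

-- Grafting

LIso-++ˡ : ∀ {as bs} → LIso as bs → ∀ cs → LIso (as ++ cs) (bs ++ cs)
LIso-++ˡ [] cs = LIso-refl cs
LIso-++ˡ (i ∷ p) cs = i ∷ LIso-++ˡ p cs
LIso-++ˡ (swap t u ts) cs = swap t u (ts ++ cs)
LIso-++ˡ (p ⨾ q) cs = LIso-++ˡ p cs ⨾ LIso-++ˡ q cs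

LIso-++ʳ : ∀ as {cs ds} → LIso cs ds → LIso (as ++ cs) (as ++ ds)
LIso-++ʳ [] q = q
LIso-++ʳ (a ∷ as) q = Iso-refl a ∷ LIso-++ʳ as q

LIso-++ : ∀ {as bs cs ds} → LIso as bs → LIso cs ds → LIso (as ++ cs) (bs ++ ds)
LIso-++ {bs = bs} {cs} p q = LIso-++ˡ p cs ⨾ LIso-++ʳ bs q

LIso-map : (g : PTree → PTree) → (∀ {a b} → Iso a b → Iso (g a) (g b)) →
  ∀ {as bs} → LIso as bs → LIso (map g as) (map g bs)
LIso-map g g-iso [] = []
LIso-map g g-iso (i ∷ p) = g-iso i ∷ LIso-map g g-iso p
LIso-map g g-iso (swap t u ts) = swap (g t) (g u) (map g ts)
LIso-map g g-iso (p ⨾ q) = LIso-map g g-iso p ⨾ LIso-map g g-iso q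

LIso-map-pointwise : (g h : PTree → PTree) → (∀ a → Iso (g a) (h a)) → ∀ as → LIso (map g as) (map h as)
LIso-map-pointwise g h gh [] = []
LIso-map-pointwise g h gh (a ∷ as) = gh a ∷ LIso-map-pointwise g h gh as

LIso-map₂ : (g h : PTree → PTree) → (∀ {a b} → Iso a b → Iso (g a) (h b)) →
  ∀ {as bs} → LIso as bs → LIso (map g as) (map h bs)
LIso-map₂ g h gh {bs = bs} p =
  LIso-map g (λ {a} {b} i → Iso-trans (gh i) (Iso-sym (gh (Iso-refl b)))) p ⨾ LIso-map-pointwise g h (λ a → gh (Iso-refl a)) bs

LIso-shift : ∀ x ys zs → LIso (x ∷ ys ++ zs) (ys ++ x ∷ zs)
LIso-shift x [] zs = LIso-refl _
LIso-shift x (y ∷ ys) zs = swap x y (ys ++ zs) ⨾ (Iso-refl y ∷ LIso-shift x ys zs)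

LIso-swapBlocks : ∀ xs ys zs → LIso (xs ++ ys ++ zs) (ys ++ xs ++ zs)
LIso-swapBlocks [] ys zs = LIso-refl _
LIso-swapBlocks (x ∷ xs) ys zs = (Iso-refl x ∷ LIso-swapBlocks xs ys zs) ⨾ LIso-shift x ys (xs ++ zs)

addChild : PTree → PTree → PTree
addChild t (node ts) = node (t ∷ ts)

addChild-Iso : ∀ {t t' a b} → Iso t t' → Iso a b → Iso (addChild t a) (addChild t' b)
addChild-Iso i (node p) = node (i ∷ p)

graftAtF-∷ : ∀ u t ts → map node (graftAtF u (t ∷ ts)) ≡
  map (λ w → node (w ∷ ts)) (graftAt u t) ++ map (addChild t) (map node (graftAtF u ts))
graftAtF-∷ u t ts = trans (List.map-++ node (map (_∷ ts) (graftAt u t)) _)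
  (cong₂ _++_ (sym (List.map-∘ (graftAt u t))) (trans (sym (List.map-∘ (graftAtF u ts))) (List.map-∘ (graftAtF u ts))))

graftAtF-∷∷ : ∀ u t v ts → map node (graftAtF u (t ∷ v ∷ ts)) ≡
  map (λ w → node (w ∷ v ∷ ts)) (graftAt u t) ++
  (map (λ w → node (t ∷ w ∷ ts)) (graftAt u v) ++ map (addChild t ∘ addChild v) (map node (graftAtF u ts)))
graftAtF-∷∷ u t v ts = trans (graftAtF-∷ u t (v ∷ ts)) (cong (map (λ w → node (w ∷ v ∷ ts)) (graftAt u t) ++_)
  (trans (cong (map (addChild t)) (graftAtF-∷ u v ts))
    (trans (List.map-++ (addChild t) (map (λ w → node (w ∷ ts)) (graftAt u v)) _)
      (cong₂ _++_ (sym (List.map-∘ (graftAt u v))) (sym (List.map-∘ (map node (graftAtF u ts))))))))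

LIso-≡ : ∀ {as as' bs bs'} → as ≡ as' → bs ≡ bs' → LIso as' bs' → LIso as bs
LIso-≡ refl refl p = p

mutual
  graftAt-Isoˡ : ∀ {u u'} → Iso u u' → ∀ t → LIso (graftAt u t) (graftAt u' t)
  graftAt-Isoˡ i (node ts) = node (LIso-++ (LIso-refl ts) (i ∷ [])) ∷ graftAtF-Isoˡ i ts

  graftAtF-Isoˡ : ∀ {u u'} → Iso u u' → ∀ ts → LIso (map node (graftAtF u ts)) (map node (graftAtF u' ts))
  graftAtF-Isoˡ i [] = []
  graftAtF-Isoˡ {u} {u'} i (t ∷ ts) = LIso-≡ (graftAtF-∷ u t ts) (graftAtF-∷ u' t ts)
    (LIso-++ (LIso-map (λ w → node (w ∷ ts)) (λ j → node (j ∷ LIso-refl ts)) (graftAt-Isoˡ i t))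
             (LIso-map (addChild t) (addChild-Iso (Iso-refl t)) (graftAtF-Isoˡ i ts)))

mutual
  graftAt-Isoʳ : ∀ u {t t'} → Iso t t' → LIso (graftAt u t) (graftAt u t')
  graftAt-Isoʳ u (node p) = node (LIso-++ p (LIso-refl _)) ∷ graftAtF-Isoʳ u p

  graftAtF-Isoʳ : ∀ u {ts ts'} → LIso ts ts' → LIso (map node (graftAtF u ts)) (map node (graftAtF u ts'))
  graftAtF-Isoʳ u [] = []
  graftAtF-Isoʳ u (_∷_ {t} {t'} {ts} {ts'} i p) = LIso-≡ (graftAtF-∷ u t ts) (graftAtF-∷ u t' ts')
    (LIso-++ (LIso-map₂ (λ w → node (w ∷ ts)) (λ w → node (w ∷ ts')) (λ j → node (j ∷ p)) (graftAt-Isoʳ u i))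
             (LIso-map₂ (addChild t) (addChild t') (addChild-Iso i) (graftAtF-Isoʳ u p)))
  graftAtF-Isoʳ u (swap t v ts) = LIso-≡ (graftAtF-∷∷ u t v ts) (graftAtF-∷∷ u v t ts)
    (LIso-++ (LIso-map-pointwise _ _ (λ w → node (swap w v ts)) (graftAt u t))
       (LIso-++ (LIso-map-pointwise _ _ (λ w → node (swap t w ts)) (graftAt u v))
                (LIso-map-pointwise _ _ addChildren-swap (map node (graftAtF u ts))))
     ⨾ LIso-swapBlocks (map (λ w → node (v ∷ w ∷ ts)) (graftAt u t)) (map (λ w → node (w ∷ t ∷ ts)) (graftAt u v)) _)
    where
    addChildren-swap : ∀ a → Iso (addChild t (addChild v a)) (addChild v (addChild t a))
    addChildren-swap (node as) = node (swap t v as)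
  graftAtF-Isoʳ u (p ⨾ q) = graftAtF-Isoʳ u p ⨾ graftAtF-Isoʳ u q

sizeF-++ : ∀ as bs → sizeF (as ++ bs) ≡ sizeF as ℕ.+ sizeF bs
sizeF-++ [] bs = refl
sizeF-++ (a ∷ as) bs = trans (cong (size a ℕ.+_) (sizeF-++ as bs)) (sym (ℕₚ.+-assoc (size a) _ _))

mutual
  graftAt-size : ∀ u t → All (λ w → size w ≡ size u ℕ.+ size t) (graftAt u t)
  graftAt-size u (node ts) =
    newChild ∷ All.map⁺ (All.map (λ e → trans (cong suc e) (sym (ℕₚ.+-suc (size u) _))) (graftAtF-size u ts))
    where
    newChild : suc (sizeF (ts ++ [ u ])) ≡ size u ℕ.+ suc (sizeF ts)
    newChild = begin
      suc (sizeF (ts ++ [ u ]))          ≡⟨ cong suc (sizeF-++ ts [ u ]) ⟩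
      suc (sizeF ts ℕ.+ (size u ℕ.+ 0))  ≡⟨ cong (λ z → suc (sizeF ts ℕ.+ z)) (ℕₚ.+-identityʳ (size u)) ⟩
      suc (sizeF ts ℕ.+ size u)          ≡⟨ cong suc (ℕₚ.+-comm (sizeF ts) (size u)) ⟩
      suc (size u ℕ.+ sizeF ts)          ≡⟨ ℕₚ.+-suc (size u) (sizeF ts) ⟨
      size u ℕ.+ suc (sizeF ts)          ∎

  graftAtF-size : ∀ u ts → All (λ ws → sizeF ws ≡ size u ℕ.+ sizeF ts) (graftAtF u ts)
  graftAtF-size u [] = []
  graftAtF-size u (t ∷ ts) = All.++⁺
    (All.map⁺ (All.map (λ e → trans (cong (ℕ._+ sizeF ts) e) (ℕₚ.+-assoc (size u) (size t) _)) (graftAt-size u t)))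
    (All.map⁺ (All.map (λ e → trans (cong (size t ℕ.+_) e) (+-leftComm (size t) (size u) (sizeF ts))) (graftAtF-size u ts)))

∑-LIso : (f : PTree → ℚ) → (∀ {a b} → Iso a b → f a ≡ f b) → ∀ {as bs} → LIso as bs → ∑ f as ≡ ∑ f bs
∑-LIso f f-iso [] = refl
∑-LIso f f-iso (i ∷ p) = cong₂ _+_ (f-iso i) (∑-LIso f f-iso p)
∑-LIso f f-iso (swap t u ts) = ℚ-+-leftComm (f t) (f u) (∑ f ts)
∑-LIso f f-iso (p ⨾ q) = trans (∑-LIso f f-iso p) (∑-LIso f f-iso q)

graftCount : PTree → PTree → PTree → ℚ
graftCount s u t = ∑ (λ w → when (sameTree s w) 1ℚ) (graftAt u t)

graftCount-Iso : ∀ s {u u' t t'} → Iso u u' → Iso t t' → graftCount s u t ≡ graftCount s u' t'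
graftCount-Iso s {u} {u'} {t} i j = ∑-LIso (λ w → when (sameTree s w) 1ℚ)
  (λ k → cong (λ z → when (eqT (canon s) z) 1ℚ) (Iso⇒canon≡ k))
  (graftAt-Isoˡ i t ⨾ graftAt-Isoʳ u' j)

sameTree-size≢ : ∀ s w → (size s ≡ size w → ⊥) → sameTree s w ≡ false
sameTree-size≢ s w ne with sameTree s w in e
... | true = ⊥-elim (ne (sameTree⇒size≡ s w e))
... | false = refl

graftCount-size≢ : ∀ s u t → (size s ≡ size u ℕ.+ size t → ⊥) → graftCount s u t ≡ 0ℚ
graftCount-size≢ s u t ne = trans
  (∑-congᴬ (graftAt-size u t) (λ w w≡ → cong (λ b → when b 1ℚ) (sameTree-size≢ s w (λ s≡ → ne (trans s≡ w≡)))))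
  (∑-zero (λ _ → refl) (graftAt u t))

coefL-⇀ : ∀ s x y → coefL s (x ⇀ y) ≡ pairing x (λ u → pairing y (graftCount s u))
coefL-⇀ s x y = trans (∑-concatMap _ _ x) (∑-cong term x)
  where
  term : ∀ p → coefL s (concatMap (λ q → map (λ w → (proj₁ p * proj₁ q , w)) (graftAt (proj₂ p) (proj₂ q))) y)
             ≡ proj₁ p * pairing y (graftCount s (proj₂ p))
  term (a , u) = begin
    coefL s (concatMap (λ q → map (λ w → (a * proj₁ q , w)) (graftAt u (proj₂ q))) y)
      ≡⟨ ∑-concatMap _ (λ q → map (λ w → (a * proj₁ q , w)) (graftAt u (proj₂ q))) y ⟩
    ∑ (λ q → coefL s (map (λ w → (a * proj₁ q , w)) (graftAt u (proj₂ q)))) y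
      ≡⟨ ∑-cong (λ q → ∑-map _ (λ w → (a * proj₁ q , w)) (graftAt u (proj₂ q))) y ⟩
    ∑ (λ q → ∑ (λ w → when (sameTree s w) (a * proj₁ q)) (graftAt u (proj₂ q))) y
      ≡⟨ ∑-cong (λ q → trans (∑-cong (λ w → scale (sameTree s w) (a * proj₁ q)) (graftAt u (proj₂ q)))
                             (sym (∑-*ˡ (a * proj₁ q) _ (graftAt u (proj₂ q))))) y ⟩
    ∑ (λ q → (a * proj₁ q) * graftCount s u (proj₂ q)) y
      ≡⟨ ∑-cong (λ q → *-assoc a (proj₁ q) _) y ⟩
    ∑ (λ q → a * (proj₁ q * graftCount s u (proj₂ q))) y
      ≡⟨ ∑-*ˡ a _ y ⟨
    a * pairing y (graftCount s u) ∎
    where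
    scale : ∀ b c → when b c ≡ c * when b 1ℚ
    scale true c = sym (*-identityʳ c)
    scale false c = sym (*-zeroʳ c)

graftCount-large : ∀ s u t → size s < size u ℕ.+ size t → graftCount s u t ≡ 0ℚ
graftCount-large s u t s< = graftCount-size≢ s u t (λ s≡ → ℕₚ.<-irrefl s≡ s<)

graftCount-largeˡ : ∀ s u t → size s ≤ size u → graftCount s u t ≡ 0ℚ
graftCount-largeˡ s u t s≤u = graftCount-large s u t (ℕₚ.≤-trans (s≤s s≤u)
  (ℕₚ.≤-trans (ℕₚ.≤-reflexive (ℕₚ.+-comm 1 (size u))) (ℕₚ.+-monoʳ-≤ (size u) (size≥1 t))))

graftCount-largeʳ : ∀ s u t → size s ≤ size t → graftCount s u t ≡ 0ℚ
graftCount-largeʳ s u t s≤t = graftCount-large s u t (ℕₚ.≤-trans (s≤s s≤t) (ℕₚ.+-monoˡ-≤ (size t) (size≥1 u)))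

coefL-⇀-∑T≤ : ∀ s x y → coefL s (x ⇀ y) ≡
  ∑T≤ (size s) (λ u → coefL u x * ∑T≤ (size s) (λ t → coefL t y * graftCount s u t))
coefL-⇀-∑T≤ s x y = begin
  coefL s (x ⇀ y)
    ≡⟨ coefL-⇀ s x y ⟩
  pairing x (λ u → pairing y (graftCount s u))
    ≡⟨ ∑-cong (λ p → cong (proj₁ p *_) (pairing-coefL (size s) (graftCount s (proj₂ p))
          (λ t → graftCount-Iso s (Iso-refl (proj₂ p)) (Iso-sym (Iso-canon t)))
          (λ t s<t → graftCount-largeʳ s (proj₂ p) t (ℕₚ.<⇒≤ s<t)) y)) x ⟩
  pairing x (λ u → ∑T≤ (size s) (λ t → coefL t y * graftCount s u t))
    ≡⟨ pairing-coefL (size s) _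
         (λ u → ∑T≤-cong (size s) (λ t → cong (coefL t y *_) (graftCount-Iso s (Iso-sym (Iso-canon u)) (Iso-refl t))))
         (λ u s<u → ∑T≤-zero (size s) (λ t → trans (cong (coefL t y *_) (graftCount-largeˡ s u t (ℕₚ.<⇒≤ s<u))) (*-zeroʳ (coefL t y))))
         x ⟩
  ∑T≤ (size s) (λ u → coefL u x * ∑T≤ (size s) (λ t → coefL t y * graftCount s u t)) ∎

AgreeBelow : ℕ → Lin → Lin → Set
AgreeBelow k x x' = ∀ t → size t < k → coefL t x ≡ coefL t x'

*-agree-on-support : ∀ n {a a' g : PTree → ℚ} → (∀ t → size t < n → a t ≡ a' t) → (∀ t → n ≤ size t → g t ≡ 0ℚ) →
  ∀ t → a t * g t ≡ a' t * g t
*-agree-on-support n {a} {a'} {g} agree vanish t with size t ℕ.<? n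
... | yes t<n = cong (_* g t) (agree t t<n)
... | no t≮n = begin
  a t * g t   ≡⟨ cong (a t *_) (vanish t (ℕₚ.≮⇒≥ t≮n)) ⟩
  a t * 0ℚ    ≡⟨ *-zeroʳ (a t) ⟩
  0ℚ          ≡⟨ *-zeroʳ (a' t) ⟨
  a' t * 0ℚ   ≡⟨ cong (a' t *_) (vanish t (ℕₚ.≮⇒≥ t≮n)) ⟨
  a' t * g t  ∎

coefL-⇀-local : ∀ k {x x' y y'} → AgreeBelow k x x' → AgreeBelow k y y' →
  ∀ s → size s ≤ k → coefL s (x ⇀ y) ≡ coefL s (x' ⇀ y')
coefL-⇀-local k {x} {x'} {y} {y'} x≈x' y≈y' s s≤k = begin
  coefL s (x ⇀ y)
    ≡⟨ coefL-⇀-∑T≤ s x y ⟩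
  ∑T≤ (size s) (λ u → coefL u x * ∑T≤ (size s) (λ t → coefL t y * graftCount s u t))
    ≡⟨ ∑T≤-cong (size s) (λ u → cong (coefL u x *_) (∑T≤-cong (size s)
         (*-agree-on-support (size s) {g = graftCount s u} (below {y} {y'} y≈y') (λ t → graftCount-largeʳ s u t)))) ⟩
  ∑T≤ (size s) (λ u → coefL u x * ∑T≤ (size s) (λ t → coefL t y' * graftCount s u t))
    ≡⟨ ∑T≤-cong (size s) (*-agree-on-support (size s) {g = λ u → ∑T≤ (size s) (λ t → coefL t y' * graftCount s u t)}
         (below {x} {x'} x≈x')
         (λ u s≤u → ∑T≤-zero (size s) (λ t →
            trans (cong (coefL t y' *_) (graftCount-largeˡ s u t s≤u)) (*-zeroʳ (coefL t y'))))) ⟩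
  ∑T≤ (size s) (λ u → coefL u x' * ∑T≤ (size s) (λ t → coefL t y' * graftCount s u t))
    ≡⟨ coefL-⇀-∑T≤ s x' y' ⟨
  coefL s (x' ⇀ y') ∎
  where
  below : ∀ {z z'} → AgreeBelow k z z' → ∀ t → size t < size s → coefL t z ≡ coefL t z'
  below z≈z' t t<s = z≈z' t (ℕₚ.<-≤-trans t<s s≤k)

iterL-local : ∀ k {y y'} → AgreeBelow k y y' → ∀ m s → size s ≤ k → coefL s (iterL m y) ≡ coefL s (iterL m y')
iterL-local k y≈y' zero s _ = refl
iterL-local k {y} {y'} y≈y' (suc m) s s≤k =
  coefL-⇀-local k {y} {y'} {iterL m y} {iterL m y'} y≈y' (λ t t<k → iterL-local k y≈y' m t (ℕₚ.<⇒≤ t<k)) s s≤k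

-- Uniqueness

magnus-unique : ∀ X Y → IsMagnus X → IsMagnus Y → X ≈S Y
magnus-unique X Y X-magnus Y-magnus s = agreeBelow (suc (size s)) s ℕₚ.≤-refl
  where
  agreeBelow : ∀ n s → size s < n → coef X s ≡ coef Y s
  agreeBelow (suc n) s (s≤s s≤n) = begin
    coef X s
      ≡⟨ X-magnus s ⟩
    sumTo (size s) (λ m → bern m * coefL s (iterL m (trunc (size s) X)))
      ≡⟨ ∑<-cong (suc (size s)) (λ m _ → cong (bern m *_)
           (iterL-local (size s) {trunc (size s) X} {trunc (size s) Y} truncs-agree m s ℕₚ.≤-refl)) ⟩
    sumTo (size s) (λ m → bern m * coefL s (iterL m (trunc (size s) Y)))
      ≡⟨ Y-magnus s ⟨
    coef Y s ∎
    where
    truncs-agree : AgreeBelow (size s) (trunc (size s) X) (trunc (size s) Y)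
    truncs-agree t t<s = begin
      coefL t (trunc (size s) X)                   ≡⟨ coefL-trunc (size s) X t ⟩
      when (size t <ᵇ suc (size s)) (coef X t)      ≡⟨ cong (when (size t <ᵇ suc (size s))) (agreeBelow n t (ℕₚ.<-≤-trans t<s s≤n)) ⟩
      when (size t <ᵇ suc (size s)) (coef Y t)      ≡⟨ coefL-trunc (size s) Y t ⟨
      coefL t (trunc (size s) Y)                   ∎

-- Existence

scale : ℚ → Lin → Lin
scale a = map (λ p → (a * proj₁ p , proj₂ p))

lincomb : {A : Set} → (A → ℚ) → (A → Lin) → List A → Lin
lincomb a x = concatMap (λ i → scale (a i) (x i))

pairing-scale : ∀ a x φ → pairing (scale a x) φ ≡ a * pairing x φ
pairing-scale a x φ = begin
  pairing (scale a x) φ                        ≡⟨ ∑-map _ (λ p → (a * proj₁ p , proj₂ p)) x ⟩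
  ∑ (λ p → a * proj₁ p * φ (proj₂ p)) x        ≡⟨ ∑-cong (λ p → *-assoc a (proj₁ p) (φ (proj₂ p))) x ⟩
  ∑ (λ p → a * (proj₁ p * φ (proj₂ p))) x      ≡⟨ ∑-*ˡ a _ x ⟨
  a * pairing x φ                              ∎

pairing-lincomb : ∀ {A : Set} (a : A → ℚ) x is φ → pairing (lincomb a x is) φ ≡ ∑ (λ i → a i * pairing (x i) φ) is
pairing-lincomb a x is φ = trans (∑-concatMap _ (λ i → scale (a i) (x i)) is) (∑-cong (λ i → pairing-scale (a i) (x i) φ) is)

coefL-pairing : ∀ s y → coefL s y ≡ pairing y (λ t → when (sameTree s t) 1ℚ)
coefL-pairing s y = ∑-cong (λ { (q , u) → unit (sameTree s u) q }) y
  where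
  unit : ∀ b q → when b q ≡ q * when b 1ℚ
  unit true q = sym (*-identityʳ q)
  unit false q = sym (*-zeroʳ q)

coefL-lincomb : ∀ {A : Set} s (a : A → ℚ) x is → coefL s (lincomb a x is) ≡ ∑ (λ i → a i * coefL s (x i)) is
coefL-lincomb s a x is = begin
  coefL s (lincomb a x is)                                    ≡⟨ coefL-pairing s (lincomb a x is) ⟩
  pairing (lincomb a x is) (λ t → when (sameTree s t) 1ℚ)     ≡⟨ pairing-lincomb a x is _ ⟩
  ∑ (λ i → a i * pairing (x i) (λ t → when (sameTree s t) 1ℚ)) is ≡⟨ ∑-cong (λ i → cong (a i *_) (coefL-pairing s (x i))) is ⟨
  ∑ (λ i → a i * coefL s (x i)) is                            ∎

pairing-* : ∀ x c (φ : PTree → ℚ) → pairing x (λ u → c * φ u) ≡ c * pairing x φ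
pairing-* x c φ = begin
  ∑ (λ p → proj₁ p * (c * φ (proj₂ p))) x
    ≡⟨ ∑-cong (λ p → solve 3 (λ q c f → q :* (c :* f) := c :* (q :* f)) refl (proj₁ p) c (φ (proj₂ p))) x ⟩
  ∑ (λ p → c * (proj₁ p * φ (proj₂ p))) x
    ≡⟨ ∑-*ˡ c _ x ⟨
  c * pairing x φ ∎

pairing-∑ : ∀ {B : Set} x (f : B → PTree → ℚ) js → pairing x (λ u → ∑ (λ j → f j u) js) ≡ ∑ (λ j → pairing x (f j)) js
pairing-∑ x f js = begin
  ∑ (λ p → proj₁ p * ∑ (λ j → f j (proj₂ p)) js) x     ≡⟨ ∑-cong (λ p → ∑-*ˡ (proj₁ p) _ js) x ⟩
  ∑ (λ p → ∑ (λ j → proj₁ p * f j (proj₂ p)) js) x     ≡⟨ ∑-comm (λ p j → proj₁ p * f j (proj₂ p)) x js ⟩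
  ∑ (λ j → pairing x (f j)) js                         ∎

coefL-⇀-lincomb : ∀ {A B : Set} s (a : A → ℚ) x is (b : B → ℚ) y js →
  coefL s (lincomb a x is ⇀ lincomb b y js) ≡ ∑ (λ i → ∑ (λ j → (a i * b j) * coefL s (x i ⇀ y j)) js) is
coefL-⇀-lincomb s a x is b y js = begin
  coefL s (lincomb a x is ⇀ lincomb b y js)
    ≡⟨ coefL-⇀ s (lincomb a x is) (lincomb b y js) ⟩
  pairing (lincomb a x is) (λ u → pairing (lincomb b y js) (graftCount s u))
    ≡⟨ pairing-lincomb a x is _ ⟩
  ∑ (λ i → a i * pairing (x i) (λ u → pairing (lincomb b y js) (graftCount s u))) is
    ≡⟨ ∑-cong (λ i → cong (a i *_) (begin
         pairing (x i) (λ u → pairing (lincomb b y js) (graftCount s u))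
           ≡⟨ ∑-cong (λ p → cong (proj₁ p *_) (pairing-lincomb b y js (graftCount s (proj₂ p)))) (x i) ⟩
         pairing (x i) (λ u → ∑ (λ j → b j * pairing (y j) (graftCount s u)) js)
           ≡⟨ pairing-∑ (x i) (λ j u → b j * pairing (y j) (graftCount s u)) js ⟩
         ∑ (λ j → pairing (x i) (λ u → b j * pairing (y j) (graftCount s u))) js
           ≡⟨ ∑-cong (λ j → trans (pairing-* (x i) (b j) _) (cong (b j *_) (sym (coefL-⇀ s (x i) (y j))))) js ⟩
         ∑ (λ j → b j * coefL s (x i ⇀ y j)) js ∎)) is ⟩
  ∑ (λ i → a i * ∑ (λ j → b j * coefL s (x i ⇀ y j)) js) is
    ≡⟨ ∑-cong (λ i → trans (∑-*ˡ (a i) _ js) (∑-cong (λ j → sym (*-assoc (a i) (b j) _)) js)) is ⟩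
  ∑ (λ i → ∑ (λ j → (a i * b j) * coefL s (x i ⇀ y j)) js) is ∎

coefL-⇀-congʳ : ∀ s x y y' → (∀ t → coefL t y ≡ coefL t y') → coefL s (x ⇀ y) ≡ coefL s (x ⇀ y')
coefL-⇀-congʳ s x y y' y≈y' = coefL-⇀-local (size s) {x} {x} {y} {y'} (λ _ _ → refl) (λ t _ → y≈y' t) s ℕₚ.≤-refl

iterL-cong : ∀ y y' → (∀ t → coefL t y ≡ coefL t y') → ∀ m s → coefL s (iterL m y) ≡ coefL s (iterL m y')
iterL-cong y y' y≈y' m s = iterL-local (size s) {y} {y'} (λ t _ → y≈y' t) m s ℕₚ.≤-refl

module _ {A : Set} where

  tuples : ℕ → List A → List (List A)
  tuples zero xs = [] ∷ []
  tuples (suc m) xs = concatMap (λ x → map (x ∷_) (tuples m xs)) xs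

  ∑-tuples-suc : ∀ m xs (G : List A → ℚ) → ∑ G (tuples (suc m) xs) ≡ ∑ (λ x → ∑ (λ ys → G (x ∷ ys)) (tuples m xs)) xs
  ∑-tuples-suc m xs G = trans (∑-concatMap G _ xs) (∑-cong (λ x → ∑-map G (x ∷_) (tuples m xs)) xs)

  tuples-length : ∀ m xs → All (λ ys → length ys ≡ m) (tuples m xs)
  tuples-length zero xs = refl ∷ []
  tuples-length (suc m) xs = concatMap-All _ (All.tabulate {xs = xs} (λ _ → tt))
    (λ x _ → All.map⁺ (All.map (cong suc) (tuples-length m xs)))

e1PlanarTrees : ℕ → List PTree
e1PlanarTrees k = filter (λ τ → isE1 τ Data.Bool.≟ true) (planarTrees k)

e1Trees : ℕ → List PTree
e1Trees n = concatMap e1PlanarTrees (upTo (suc n))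

rhsUpTo : ℕ → Lin
rhsUpTo n = lincomb γ Ψ (e1Trees n)

iterL-rhsUpTo : ∀ m n s → coefL s (iterL m (rhsUpTo n)) ≡ coefL s (lincomb γF ΨF (tuples m (e1Trees n)))
iterL-rhsUpTo zero n s = sym (begin
  coefL s (lincomb γF ΨF ([] ∷ []))   ≡⟨ coefL-lincomb s γF ΨF ([] ∷ []) ⟩
  1ℚ * coefL s •L + 0ℚ               ≡⟨ +-identityʳ _ ⟩
  1ℚ * coefL s •L                    ≡⟨ *-identityˡ _ ⟩
  coefL s •L                         ∎)
iterL-rhsUpTo (suc m) n s = begin
  coefL s (rhsUpTo n ⇀ iterL m (rhsUpTo n))
    ≡⟨ coefL-⇀-congʳ s (rhsUpTo n) (iterL m (rhsUpTo n)) (lincomb γF ΨF (tuples m L)) (λ t → iterL-rhsUpTo m n t) ⟩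
  coefL s (lincomb γ Ψ L ⇀ lincomb γF ΨF (tuples m L))
    ≡⟨ coefL-⇀-lincomb s γ Ψ L γF ΨF (tuples m L) ⟩
  ∑ (λ τ → ∑ (λ F → γF (τ ∷ F) * coefL s (ΨF (τ ∷ F))) (tuples m L)) L
    ≡⟨ ∑-tuples-suc m L (λ F → γF F * coefL s (ΨF F)) ⟨
  ∑ (λ F → γF F * coefL s (ΨF F)) (tuples (suc m) L)
    ≡⟨ coefL-lincomb s γF ΨF (tuples (suc m) L) ⟨
  coefL s (lincomb γF ΨF (tuples (suc m) L)) ∎
  where L = e1Trees n

HasSize : ℕ → Lin → Set
HasSize k x = All (λ p → size (proj₂ p) ≡ k) x

⇀-size : ∀ a c x y → HasSize a x → HasSize c y → HasSize (a ℕ.+ c) (x ⇀ y)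
⇀-size a c x y x∈a y∈c = concatMap-All _ x∈a λ { (_ , u) u≡a → concatMap-All _ y∈c λ { (_ , t) t≡c →
  All.map⁺ (All.map (λ w≡ → trans w≡ (cong₂ ℕ._+_ u≡a t≡c)) (graftAt-size u t)) } }

mutual
  Ψ-size : ∀ τ → HasSize (size τ) (Ψ τ)
  Ψ-size (node ts) = ΨF-size ts

  ΨF-size : ∀ ts → HasSize (suc (sizeF ts)) (ΨF ts)
  ΨF-size [] = refl ∷ []
  ΨF-size (t ∷ ts) = All.map (λ e → trans e (ℕₚ.+-suc (size t) (sizeF ts)))
    (⇀-size (size t) (suc (sizeF ts)) (Ψ t) (ΨF ts) (Ψ-size t) (ΨF-size ts))

coefL-size≢ : ∀ s k x → HasSize k x → (size s ≡ k → ⊥) → coefL s x ≡ 0ℚ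
coefL-size≢ s k x x∈k s≢k = trans
  (∑-congᴬ x∈k (λ p p≡k → cong (λ b → when b (proj₁ p)) (sameTree-size≢ s (proj₂ p) (λ s≡ → s≢k (trans s≡ p≡k)))))
  (∑-zero (λ _ → refl) x)

α-size≢ : ∀ s τ → (size s ≡ size τ → ⊥) → α s τ ≡ 0ℚ
α-size≢ s τ = coefL-size≢ s (size τ) (Ψ τ) (Ψ-size τ)

≡ᵇ⇒≡ : ∀ a b → (a ≡ᵇ b) ≡ true → a ≡ b
≡ᵇ⇒≡ a b e = ℕₚ.≡ᵇ⇒≡ a b (subst T (sym e) tt)

coefL-rhsUpTo : ∀ n s → coefL s (rhsUpTo n) ≡ when (size s <ᵇ suc n) (rhs s)
coefL-rhsUpTo n s = begin
  coefL s (rhsUpTo n)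
    ≡⟨ coefL-lincomb s γ Ψ (e1Trees n) ⟩
  ∑ (λ τ → γ τ * α s τ) (e1Trees n)
    ≡⟨ ∑-concatMap (λ τ → γ τ * α s τ) e1PlanarTrees (upTo (suc n)) ⟩
  ∑< (suc n) (λ k → ∑ (λ τ → γ τ * α s τ) (e1PlanarTrees k))
    ≡⟨ ∑<-cong (suc n) (λ k _ → sizeSlice k) ⟩
  ∑< (suc n) (λ k → when (k ≡ᵇ size s) (rhs s))
    ≡⟨ ∑<-indicator (suc n) (size s) (λ _ → rhs s) ⟩
  when (size s <ᵇ suc n) (rhs s) ∎
  where
  sizeSlice : ∀ k → ∑ (λ τ → γ τ * α s τ) (e1PlanarTrees k) ≡ when (k ≡ᵇ size s) (rhs s)
  sizeSlice k with k ≡ᵇ size s in k≡s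
  ... | true rewrite ≡ᵇ⇒≡ k (size s) k≡s = refl
  ... | false = trans (∑-filter isE1 _ (planarTrees k)) (trans
    (∑-congᴬ (treesF-size k k) (λ τ τ≡k → trans (cong (λ z → when (isE1 τ) (γ τ * z)) (α-size≢ s τ λ s≡τ →
                 subst T k≡s (ℕₚ.≡⇒≡ᵇ k (size s) (trans (sym τ≡k) (sym s≡τ)))))
               (cong (when (isE1 τ)) (*-zeroʳ (γ τ)))))
    (∑-zero (λ τ → when-0 (isE1 τ)) (planarTrees k)))

rhs-canon : ∀ s → rhs (canon s) ≡ rhs s
rhs-canon s = trans (cong (λ k → ∑ (λ τ → γ τ * α (canon s) τ) (e1PlanarTrees k)) (size-canon s))
  (∑-cong (λ τ → cong (γ τ *_) (∑-cong (λ p → cong (λ c → when (eqT c (canon (proj₂ p))) (proj₁ p)) (canon-idem s)) (Ψ τ)))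
          (e1PlanarTrees (size s)))

coefL-trunc-rhs : ∀ n t → coefL t (trunc n rhs) ≡ coefL t (rhsUpTo n)
coefL-trunc-rhs n t = begin
  coefL t (trunc n rhs)                       ≡⟨ coefL-trunc n rhs t ⟩
  when (size t <ᵇ suc n) (rhs (canon t))      ≡⟨ cong (when (size t <ᵇ suc n)) (rhs-canon t) ⟩
  when (size t <ᵇ suc n) (rhs t)              ≡⟨ coefL-rhsUpTo n t ⟨
  coefL t (rhsUpTo n)                         ∎

bern-tuples : ∀ m n s → bern m * coefL s (lincomb γF ΨF (tuples m (e1Trees n))) ≡
  ∑ (λ F → γ (node F) * α s (node F)) (tuples m (e1Trees n))
bern-tuples m n s = begin
  bern m * coefL s (lincomb γF ΨF Fs)        ≡⟨ cong (bern m *_) (coefL-lincomb s γF ΨF Fs) ⟩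
  bern m * ∑ (λ F → γF F * coefL s (ΨF F)) Fs ≡⟨ ∑-*ˡ (bern m) _ Fs ⟩
  ∑ (λ F → bern m * (γF F * coefL s (ΨF F))) Fs
    ≡⟨ ∑-congᴬ (tuples-length m (e1Trees n)) (λ F F≡m → trans (sym (*-assoc (bern m) (γF F) _))
         (cong (λ k → bern k * γF F * coefL s (ΨF F)) (sym F≡m))) ⟩
  ∑ (λ F → γ (node F) * α s (node F)) Fs     ∎
  where Fs = tuples m (e1Trees n)

∑<-tuples : ∀ {A : Set} M (xs : List A) (G : List A → ℚ) → ∑< (suc M) (λ m → ∑ G (tuples m xs)) ≡
  G [] + ∑< M (λ m → ∑ (λ x → ∑ (λ ys → G (x ∷ ys)) (tuples m xs)) xs)
∑<-tuples M xs G = begin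
  ∑< (suc M) (λ m → ∑ G (tuples m xs))
    ≡⟨ ∑<-suc M (λ m → ∑ G (tuples m xs)) ⟩
  (G [] + 0ℚ) + ∑< M (λ m → ∑ G (tuples (suc m) xs))
    ≡⟨ cong₂ _+_ (+-identityʳ (G [])) (∑<-cong M (λ m _ → ∑-tuples-suc m xs G)) ⟩
  G [] + ∑< M (λ m → ∑ (λ x → ∑ (λ ys → G (x ∷ ys)) (tuples m xs)) xs) ∎

sizeF-∷-≢0 : ∀ t ts → sizeF (t ∷ ts) ≡ 0 → ⊥
sizeF-∷-≢0 (node _) ts ()

∑-e1Trees : ∀ n K (h : PTree → ℚ) → K ≤ n → (∀ t → K < size t → h t ≡ 0ℚ) →
  ∑ h (e1Trees n) ≡ ∑< K (λ k → ∑ (λ t → when (isE1 t) (h t)) (planarTrees (suc k)))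
∑-e1Trees n K h K≤n vanish = begin
  ∑ h (e1Trees n)
    ≡⟨ ∑-concatMap h e1PlanarTrees (upTo (suc n)) ⟩
  ∑< (suc n) (λ j → ∑ h (e1PlanarTrees j))
    ≡⟨ ∑<-cong (suc n) (λ j _ → ∑-filter isE1 h (planarTrees j)) ⟩
  ∑< (suc n) (λ j → ∑ (λ t → when (isE1 t) (h t)) (planarTrees j))
    ≡⟨ ∑<-suc n (λ j → ∑ (λ t → when (isE1 t) (h t)) (planarTrees j)) ⟩
  0ℚ + ∑< n (λ k → ∑ (λ t → when (isE1 t) (h t)) (planarTrees (suc k)))
    ≡⟨ +-identityˡ _ ⟩
  ∑< n (λ k → ∑ (λ t → when (isE1 t) (h t)) (planarTrees (suc k)))
    ≡⟨ ∑<-extend K n K≤n (λ k K≤k → trans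
         (∑-congᴬ (treesF-size (suc k) (suc k)) (λ t t≡ →
            trans (cong (when (isE1 t)) (vanish t (subst (K <_) (sym t≡) (s≤s K≤k)))) (when-0 (isE1 t))))
         (∑-zero (λ _ → refl) (planarTrees (suc k)))) ⟩
  ∑< K (λ k → ∑ (λ t → when (isE1 t) (h t)) (planarTrees (suc k))) ∎

-- A forest with N vertices whose trees lie in T^{e1}_pl is an m-tuple of elements of e1Trees n.
∑-e1Forests : ∀ n f N M (G : List PTree → ℚ) → N ≤ f → N ≤ M → N ≤ n → (∀ ts → (sizeF ts ≡ N → ⊥) → G ts ≡ 0ℚ) →
  ∑ (λ ts → when (isE1F ts) (G ts)) (forestsF f N) ≡ ∑< (suc M) (λ m → ∑ G (tuples m (e1Trees n)))
∑-e1Forests n f zero M G _ _ _ vanish = sym (begin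
  ∑< (suc M) (λ m → ∑ G (tuples m (e1Trees n)))
    ≡⟨ ∑<-tuples M (e1Trees n) G ⟩
  G [] + ∑< M (λ m → ∑ (λ t → ∑ (λ ts → G (t ∷ ts)) (tuples m (e1Trees n))) (e1Trees n))
    ≡⟨ cong (G [] +_) (∑<-zero M (λ m _ → ∑-zero (λ t →
         ∑-zero (λ ts → vanish (t ∷ ts) (sizeF-∷-≢0 t ts)) (tuples m (e1Trees n))) (e1Trees n))) ⟩
  G [] + 0ℚ ∎)
∑-e1Forests n (suc f) (suc N) (suc M) G (s≤s N≤f) (s≤s N≤M) N<n vanish = begin
  ∑ (λ ts → when (isE1F ts) (G ts)) (forestsF (suc f) (suc N))
    ≡⟨ ∑-forestsF f N (λ ts → when (isE1F ts) (G ts)) ⟩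
  ∑< (suc N) (λ k → ∑ (λ t → ∑ (λ ts → when (isE1F (t ∷ ts)) (G (t ∷ ts))) (forestsF f (N ∸ k))) (treesF (suc f) (suc k)))
    ≡⟨ ∑<-cong (suc N) (λ k k≤N → trans (cong (∑ _) (treesF≡planarTrees (suc f) (suc k) (ℕₚ.≤-trans k≤N (s≤s N≤f))))
         (∑-congᴬ (treesF-size (suc k) (suc k)) (λ t t≡ → firstTree k (ℕₚ.≤-pred k≤N) t t≡))) ⟩
  ∑< (suc N) (λ k → ∑ (λ t → ∑< (suc M) (λ m → h m t)) (planarTrees (suc k)))
    ≡⟨ ∑<-cong (suc N) (λ k _ → ∑-comm (λ t m → h m t) (planarTrees (suc k)) (upTo (suc M))) ⟩
  ∑< (suc N) (λ k → ∑< (suc M) (λ m → ∑ (h m) (planarTrees (suc k))))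
    ≡⟨ ∑-comm (λ k m → ∑ (h m) (planarTrees (suc k))) (upTo (suc N)) (upTo (suc M)) ⟩
  ∑< (suc M) (λ m → ∑< (suc N) (λ k → ∑ (h m) (planarTrees (suc k))))
    ≡⟨ ∑<-cong (suc M) (λ m _ → ∑-e1Trees n (suc N) (H m) N<n (λ t N<t →
         ∑-zero (λ ts → vanish (t ∷ ts) (tooBig t ts N<t)) (tuples m (e1Trees n)))) ⟨
  ∑< (suc M) (λ m → ∑ (H m) (e1Trees n))
    ≡⟨ +-identityˡ _ ⟨
  0ℚ + ∑< (suc M) (λ m → ∑ (H m) (e1Trees n))
    ≡⟨ cong (_+ ∑< (suc M) (λ m → ∑ (H m) (e1Trees n))) (vanish [] (λ ())) ⟨
  G [] + ∑< (suc M) (λ m → ∑ (H m) (e1Trees n))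
    ≡⟨ ∑<-tuples (suc M) (e1Trees n) G ⟨
  ∑< (suc (suc M)) (λ m → ∑ G (tuples m (e1Trees n))) ∎
  where
  H : ℕ → PTree → ℚ
  H m t = ∑ (λ ts → G (t ∷ ts)) (tuples m (e1Trees n))
  h : ℕ → PTree → ℚ
  h m t = when (isE1 t) (H m t)
  tooBig : ∀ t ts → suc N < size t → sizeF (t ∷ ts) ≡ suc N → ⊥
  tooBig t ts N<t t+ts≡N =
    ℕₚ.<-irrefl refl (ℕₚ.<-≤-trans N<t (ℕₚ.≤-trans (ℕₚ.m≤m+n (size t) (sizeF ts)) (ℕₚ.≤-reflexive t+ts≡N)))
  firstTree : ∀ k → k ≤ N → ∀ t → size t ≡ suc k →
    ∑ (λ ts → when (isE1F (t ∷ ts)) (G (t ∷ ts))) (forestsF f (N ∸ k)) ≡ ∑< (suc M) (λ m → h m t)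
  firstTree k k≤N t t≡ = begin
    ∑ (λ ts → when (isE1F (t ∷ ts)) (G (t ∷ ts))) (forestsF f (N ∸ k))
      ≡⟨ ∑-cong (λ ts → when-∧ (isE1 t) (isE1F ts) (G (t ∷ ts))) (forestsF f (N ∸ k)) ⟩
    ∑ (λ ts → when (isE1 t) (when (isE1F ts) (G (t ∷ ts)))) (forestsF f (N ∸ k))
      ≡⟨ ∑-when (isE1 t) _ (forestsF f (N ∸ k)) ⟩
    when (isE1 t) (∑ (λ ts → when (isE1F ts) (G (t ∷ ts))) (forestsF f (N ∸ k)))
      ≡⟨ cong (when (isE1 t)) (∑-e1Forests n f (N ∸ k) M (λ ts → G (t ∷ ts)) (N∸k≤ N≤f) (N∸k≤ N≤M)
           (ℕₚ.≤-trans (N∸k≤ ℕₚ.≤-refl) (ℕₚ.<⇒≤ N<n)) (λ ts ts≢ → vanish (t ∷ ts) (λ e → ts≢ (restSize ts e)))) ⟩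
    when (isE1 t) (∑< (suc M) (λ m → H m t))
      ≡⟨ ∑-when (isE1 t) (λ m → H m t) (upTo (suc M)) ⟨
    ∑< (suc M) (λ m → h m t) ∎
    where
    N∸k≤ : ∀ {X} → N ≤ X → N ∸ k ≤ X
    N∸k≤ N≤X = ℕₚ.≤-trans (ℕₚ.m∸n≤m N k) N≤X
    restSize : ∀ ts → size t ℕ.+ sizeF ts ≡ suc N → sizeF ts ≡ N ∸ k
    restSize ts e =
      trans (sym (ℕₚ.m+n∸m≡n k (sizeF ts))) (cong (_∸ k) (ℕₚ.suc-injective (trans (cong (ℕ._+ sizeF ts) (sym t≡)) e)))

rhs-magnus : IsMagnus rhs
rhs-magnus s@(node ts) = begin
  rhs (canon s)
    ≡⟨ rhs-canon s ⟩
  ∑ (λ τ → γ τ * α s τ) (e1PlanarTrees (size s))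
    ≡⟨ ∑-filter isE1 (λ τ → γ τ * α s τ) (planarTrees (size s)) ⟩
  ∑ (λ τ → when (isE1 τ) (γ τ * α s τ)) (map node (forestsF N N))
    ≡⟨ ∑-map (λ τ → when (isE1 τ) (γ τ * α s τ)) node (forestsF N N) ⟩
  ∑ (λ F → when (isE1 (node F)) (G F)) (forestsF N N)
    ≡⟨ ∑-cong rootFertility (forestsF N N) ⟩
  ∑ (λ F → when (isE1F F) (G F)) (forestsF N N)
    ≡⟨ ∑-e1Forests n N N n G ℕₚ.≤-refl (ℕₚ.n≤1+n N) (ℕₚ.n≤1+n N) wrongSize ⟩
  ∑< (suc n) (λ m → ∑ G (tuples m (e1Trees n)))
    ≡⟨ ∑<-cong (suc n) (λ m _ → trans (sym (bern-tuples m n s)) (cong (bern m *_) (sym (iterL-rhsUpTo m n s)))) ⟩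
  ∑< (suc n) (λ m → bern m * coefL s (iterL m (rhsUpTo n)))
    ≡⟨ ∑<-cong (suc n) (λ m _ → cong (bern m *_) (iterL-cong (trunc n rhs) (rhsUpTo n) (coefL-trunc-rhs n) m s)) ⟨
  sumTo n (λ m → bern m * coefL s (iterL m (trunc n rhs))) ∎
  where
  N = sizeF ts
  n = suc N
  G : List PTree → ℚ
  G F = γ (node F) * α s (node F)
  rootFertility : ∀ F → when (isE1 (node F)) (G F) ≡ when (isE1F F) (G F)
  rootFertility F with fertOK (length F) in ok
  ... | true = refl
  ... | false = sym (trans (cong (when (isE1F F)) G≡0) (when-0 (isE1F F)))
    where
    G≡0 : G F ≡ 0ℚ
    G≡0 = begin
      bern (length F) * γF F * α s (node F)  ≡⟨ cong (λ b → b * γF F * α s (node F)) (bern-odd (length F) ok) ⟩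
      0ℚ * γF F * α s (node F)               ≡⟨ cong (_* α s (node F)) (*-zeroˡ (γF F)) ⟩
      0ℚ * α s (node F)                      ≡⟨ *-zeroˡ (α s (node F)) ⟩
      0ℚ                                     ∎
  wrongSize : ∀ F → (sizeF F ≡ N → ⊥) → G F ≡ 0ℚ
  wrongSize F F≢N =
    trans (cong (γ (node F) *_) (α-size≢ s (node F) (λ e → F≢N (sym (ℕₚ.suc-injective e))))) (*-zeroʳ (γ (node F)))

mainTheorem4 : IsMagnus rhs × (∀ (X : Series) → IsMagnus X → X ≈S rhs)
mainTheorem4 = rhs-magnus , λ X X-magnus → magnus-unique X rhs X-magnus rhs-magnus
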